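{- Let $n\equiv 0\pmod 4$ with $n\geq 12$. Then there exists an $\mathrm{SH}^*(n;9)$.
   Context: An $\mathrm{H}(n;k)$ is an $n\times n$ partially filled array with entries in $\{\pm1,\dots,\pm nk\}\subset\mathbb{Z}$ such that no two entries agree in absolute value, each row and each column has exactly $k$ filled cells, and every row and every column sums to $0$ in $\mathbb{Z}$. An ordering $(a_1,\dots,a_k)$ is simple modulo $v$ if its partial sums $s_i=\sum_{j\le i}a_j$ are pairwise distinct modulo $v$. An $\mathrm{SH}^*(n;k)$ is an $\mathrm{H}(n;k)$ in which the natural ordering of each row (left to right, skipping empty cells) and each column (top to bottom, skipping empty cells) is simple both modulo $2nk+1$ and modulo $2nk+2$. -}

module Defs where

open import Data.Nat using (ℕ; suc; _*_; _≤_; NonZero)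
open import Data.Integer as ℤ using (ℤ; +_; ∣_∣)
open import Data.Integer.DivMod using (_%ℕ_)
open import Data.Fin using (Fin)
open import Data.List using (List; []; _∷_; mapMaybe; length; foldr; map; allFin)
open import Data.List.Relation.Unary.Unique.Propositional using (Unique)
open import Data.Maybe using (Maybe; just; nothing)
open import Data.Product using (_×_)
open import Relation.Binary.PropositionalEquality using (_≡_; _≢_)
open import Relation.Nullary using (¬_)

-- A partially filled n×n array with integer entries: nothing = empty cell.
Array : ℕ → Set
Array n = Fin n → Fin n → Maybe ℤ

transpose : ∀ {n} → Array n → Array n
transpose A i j = A j i

row : ∀ {n} → Array n → Fin n → List ℤ
row {n} A i = mapMaybe (A i) (allFin n)
col : ∀ {n} → Array n → Fin n → List ℤ
col A j = row (transpose A) j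

sumℤ : List ℤ → ℤ
sumℤ = foldr ℤ._+_ (+ 0)

partialSums : List ℤ → List ℤ
partialSums = go (+ 0)
  where
  go : ℤ → List ℤ → List ℤ
  go s []       = []
  go s (x ∷ xs) = (s ℤ.+ x) ∷ go (s ℤ.+ x) xs

SimpleMod : (v : ℕ) → .{{NonZero v}} → List ℤ → Set
SimpleMod v xs = Unique (map (λ s → s %ℕ v) (partialSums xs))

EntriesOK : (n k : ℕ) → Array n → Set
EntriesOK n k A =
  (∀ i j x → A i j ≡ just x → (1 ≤ ∣ x ∣) × (∣ x ∣ ≤ n * k))
  × (∀ i j i′ j′ x y → A i j ≡ just x → A i′ j′ ≡ just y →
       ∣ x ∣ ≡ ∣ y ∣ → (i ≡ i′) × (j ≡ j′))

IsHeffter : (n k : ℕ) → Array n → Set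
IsHeffter n k A =
  EntriesOK n k A
  × (∀ i → length (row A i) ≡ k) × (∀ j → length (col A j) ≡ k)
  × (∀ i → sumℤ (row A i) ≡ + 0) × (∀ j → sumℤ (col A j) ≡ + 0)

IsSHStar : (n k : ℕ) → Array n → Set
IsSHStar n k A =
  IsHeffter n k A
  × (∀ i → SimpleMod (suc (2 * n * k)) (row A i)
         × SimpleMod (suc (suc (2 * n * k))) (row A i))
  × (∀ j → SimpleMod (suc (2 * n * k)) (col A j)
         × SimpleMod (suc (suc (2 * n * k))) (col A j))

-- Write n = 4m with m ≥ 3 and cut the array into 4 × 4 blocks indexed by ℤ/m. Block row a
-- has one entry in each row of the diagonal block (a, a) and full blocks at (a, a + 1) and
-- (a, a + 2), so every row and column has 1 + 4 + 4 = 9 entries. An entry of a block with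
-- parameter ℓ ∈ [0, m) has absolute value K·m + 1 + h, where its band K and the offset
-- h ∈ {ℓ, m - 1 - ℓ, i + 2(m - 1 - ℓ)} depend only on its place in the block; the 36 bands
-- of length m are filled exactly once, so the absolute values are 1, …, 36m.
-- Up to the wrap-around of the block indices there are six kinds of rows and columns, and in
-- each the nine entries are affine forms in two natural parameters p, q (with m = 3 + p + q
-- or m = 3 + p). For such a line the sum is the zero form, and any two partial sums differ
-- by a form whose coefficients force 0 < |d| ≤ 72m; hence the line sums to 0 and its partial
-- sums are distinct modulo 72m + 1 and 72m + 2 for all parameters. These finitely many
-- coefficient conditions are decided by evaluation.

module Submission where

open import Defs
import Data.Fin.Base as Fin

pattern 0F = Fin.zero
pattern 1F = Fin.suc 0F
pattern 2F = Fin.suc 1F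
pattern 3F = Fin.suc 2F

module Arithmetic where

  open import Data.Nat
  open import Data.Nat.Properties
  open import Data.Nat.DivMod
  open import Data.Fin using (Fin; toℕ)
  open import Data.Fin.Properties using (toℕ-injective; toℕ-fromℕ<; toℕ<n)
  import Data.Integer as ℤ
  import Data.Integer.Properties as ℤ
  open import Data.Product using (_,_)
  open import Data.Sum using (_⊎_; inj₁; inj₂)
  open import Relation.Binary.PropositionalEquality

  [r+q*n]/n≡q : ∀ {r} q n .{{_ : NonZero n}} → r < n → (r + q * n) / n ≡ q
  [r+q*n]/n≡q {r} q n r<n = begin
    (r + q * n) / n       ≡⟨ +-distrib-/-∣ʳ r (n∣m*n q) ⟩
    r / n + q * n / n     ≡⟨ cong₂ _+_ (m<n⇒m/n≡0 r<n) (m*n/n≡m q n) ⟩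
    q                     ∎
    where
    open ≡-Reasoning
    open import Data.Nat.Divisibility using (n∣m*n)

  [r+q*n]%n≡r : ∀ {r} q n .{{_ : NonZero n}} → r < n → (r + q * n) % n ≡ r
  [r+q*n]%n≡r {r} q n r<n = trans ([m+kn]%n≡m%n r q n) (m<n⇒m%n≡m r<n)

  [i+q*n]mod-n≡i : ∀ {n} .{{_ : NonZero n}} (i : Fin n) q → (toℕ i + q * n) mod n ≡ i
  [i+q*n]mod-n≡i {n} i q = toℕ-injective (trans (toℕ-fromℕ< _) ([r+q*n]%n≡r q n (toℕ<n i)))

  [h+q*n]/n-below-double : ∀ {h} q n .{{_ : NonZero n}} → h < 2 * n →
                           (h + q * n) / n ≡ q ⊎ (h + q * n) / n ≡ suc q
  [h+q*n]/n-below-double {h} q n h<2n with <-≤-connex h n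
  ... | inj₁ h<n = inj₁ ([r+q*n]/n≡q q n h<n)
  ... | inj₂ n≤h with m≤n⇒∃[o]m+o≡n n≤h
  ...   | h′ , refl = inj₂ (trans (cong (_/ n) (regroup h′ q)) ([r+q*n]/n≡q (suc q) n h′<n))
    where
    h′<n : h′ < n
    h′<n = +-cancelˡ-< n h′ n (subst (n + h′ <_) (cong (n +_) (+-identityʳ n)) h<2n)
    regroup : ∀ h′ q → n + h′ + q * n ≡ h′ + suc q * n
    regroup h′ q = trans (cong (_+ q * n) (+-comm n h′)) (+-assoc h′ n (q * n))

  pos-∸ : ∀ {m k} → k ≤ m → ℤ.+ (m ∸ k) ≡ ℤ.+ m ℤ.- ℤ.+ k
  pos-∸ {m} {k} k≤m = trans (sym (ℤ.⊖-≥ k≤m)) (sym (ℤ.m-n≡m⊖n m k))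

  toℕ/-< : ∀ {n m} .{{_ : NonZero n}} (i : Fin (n * m)) → toℕ i / n < m
  toℕ/-< {n} {m} i = m<n*o⇒m/o<n (subst (toℕ i <_) (*-comm n m) (toℕ<n i))

  index-injective : ∀ {n k} .{{_ : NonZero k}} (i i′ : Fin n) →
                    toℕ i / k ≡ toℕ i′ / k → toℕ i mod k ≡ toℕ i′ mod k → i ≡ i′
  index-injective {k = k} i i′ q≡ r≡ = toℕ-injective (begin
    toℕ i                          ≡⟨ m≡m%n+[m/n]*n (toℕ i) k ⟩
    toℕ i % k + toℕ i / k * k       ≡⟨ cong₂ (λ r q → r + q * k) %≡ q≡ ⟩
    toℕ i′ % k + toℕ i′ / k * k     ≡⟨ m≡m%n+[m/n]*n (toℕ i′) k ⟨
    toℕ i′                         ∎)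
    where
    open ≡-Reasoning
    %≡ : toℕ i % k ≡ toℕ i′ % k
    %≡ = trans (sym (toℕ-fromℕ< _)) (trans (cong toℕ r≡) (toℕ-fromℕ< _))

  ∸-suc-< : ∀ {ℓ m} → ℓ < m → m ∸ suc ℓ < m
  ∸-suc-< {ℓ} {suc m} _ = s≤s (m∸n≤m m ℓ)

  ∸-suc-involutive : ∀ {ℓ m} → ℓ < m → m ∸ suc (m ∸ suc ℓ) ≡ ℓ
  ∸-suc-involutive {ℓ} {suc m} (s≤s ℓ≤m) = m∸[m∸n]≡n ℓ≤m

module Ranges where

  open import Data.Nat
  open import Data.Nat.Properties
  open import Data.Nat.DivMod using (_mod_)
  open import Data.Fin using (Fin; toℕ)
  open import Data.List using (List; []; _∷_; _++_; map; mapMaybe; concatMap; tabulate; allFin)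
  open import Data.List.Properties using (mapMaybe-++; mapMaybe-map; mapMaybe-cong; map-tabulate; tabulate-cong; ++-identityʳ)
  open import Data.List.Relation.Unary.All using (All; []; _∷_)
  import Data.List.Relation.Unary.All as All
  open import Data.List.Relation.Unary.AllPairs using (AllPairs; []; _∷_)
  open import Data.Maybe using (Maybe)
  open import Data.Product using (_×_; _,_)
  open import Function using (_∘_; id)
  open import Relation.Binary.PropositionalEquality
  open import Relation.Nullary using (yes; no)
  open import Relation.Nullary.Negation using (contradiction)
  open Arithmetic

  range : ℕ → ℕ → List ℕ
  range lo zero    = []
  range lo (suc k) = lo ∷ range (suc lo) k

  range-++ : ∀ lo x y → range lo (x + y) ≡ range lo x ++ range (lo + x) y
  range-++ lo zero    y = cong (λ l → range l y) (sym (+-identityʳ lo))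
  range-++ lo (suc x) y = cong (lo ∷_) (trans (range-++ (suc lo) x y) (cong (λ l → range (suc lo) x ++ range l y) (sym (+-suc lo x))))

  range≡tabulate : ∀ lo n → range lo n ≡ tabulate (λ (i : Fin n) → toℕ i + lo)
  range≡tabulate lo zero    = refl
  range≡tabulate lo (suc n) = cong (lo ∷_) (trans (range≡tabulate (suc lo) n) (tabulate-cong (λ i → +-suc (toℕ i) lo)))

  map-toℕ-allFin : ∀ n → map toℕ (allFin n) ≡ range 0 n
  map-toℕ-allFin n = trans (map-tabulate id toℕ) (sym (trans (range≡tabulate 0 n) (tabulate-cong (λ i → +-identityʳ (toℕ i)))))

  mapMaybe-range-blocks : ∀ {A : Set} n .{{_ : NonZero n}} (g : ℕ → Fin n → Maybe A) b k →
    mapMaybe (λ j → g (j / n) (j mod n)) (range (b * n) (k * n)) ≡ concatMap (λ b′ → mapMaybe (g b′) (allFin n)) (range b k)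
  mapMaybe-range-blocks n g b zero    = refl
  mapMaybe-range-blocks {A} n g b (suc k) = begin
    mapMaybe G (range (b * n) (n + k * n))
      ≡⟨ cong (mapMaybe G) (range-++ (b * n) n (k * n)) ⟩
    mapMaybe G (range (b * n) n ++ range (b * n + n) (k * n))
      ≡⟨ mapMaybe-++ G (range (b * n) n) _ ⟩
    mapMaybe G (range (b * n) n) ++ mapMaybe G (range (b * n + n) (k * n))
      ≡⟨ cong₂ _++_ first-block (cong (λ l → mapMaybe G (range l (k * n))) (+-comm (b * n) n)) ⟩
    mapMaybe (g b) (allFin n) ++ mapMaybe G (range (suc b * n) (k * n))
      ≡⟨ cong (mapMaybe (g b) (allFin n) ++_) (mapMaybe-range-blocks n g (suc b) k) ⟩
    mapMaybe (g b) (allFin n) ++ concatMap (λ b′ → mapMaybe (g b′) (allFin n)) (range (suc b) k) ∎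
    where
    open ≡-Reasoning
    G : ℕ → Maybe A
    G j = g (j / n) (j mod n)
    shift : Fin n → ℕ
    shift i = toℕ i + b * n
    first-block : mapMaybe G (range (b * n) n) ≡ mapMaybe (g b) (allFin n)
    first-block = begin
      mapMaybe G (range (b * n) n)
        ≡⟨ cong (mapMaybe G) (trans (range≡tabulate (b * n) n) (sym (map-tabulate id shift))) ⟩
      mapMaybe G (map shift (allFin n))
        ≡⟨ mapMaybe-map G shift (allFin n) ⟩
      mapMaybe (G ∘ shift) (allFin n)
        ≡⟨ mapMaybe-cong (λ i → cong₂ g ([r+q*n]/n≡q b n (toℕ<n i)) ([i+q*n]mod-n≡i i b)) (allFin n) ⟩
      mapMaybe (g b) (allFin n) ∎
      where open import Data.Fin.Properties using (toℕ<n)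

  mapMaybe-allFin-blocks : ∀ {A : Set} n .{{_ : NonZero n}} (g : ℕ → Fin n → Maybe A) m →
    mapMaybe (λ j → g (toℕ j / n) (toℕ j mod n)) (allFin (n * m)) ≡ concatMap (λ b → mapMaybe (g b) (allFin n)) (range 0 m)
  mapMaybe-allFin-blocks n g m = begin
    mapMaybe (G ∘ toℕ) (allFin (n * m))     ≡⟨ mapMaybe-map G toℕ (allFin (n * m)) ⟨
    mapMaybe G (map toℕ (allFin (n * m)))   ≡⟨ cong (mapMaybe G) (map-toℕ-allFin (n * m)) ⟩
    mapMaybe G (range 0 (n * m))            ≡⟨ cong (λ k → mapMaybe G (range 0 k)) (*-comm n m) ⟩
    mapMaybe G (range (0 * n) (m * n))      ≡⟨ mapMaybe-range-blocks n g 0 m ⟩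
    concatMap (λ b → mapMaybe (g b) (allFin n)) (range 0 m) ∎
    where
    open ≡-Reasoning
    G : ℕ → Maybe _
    G j = g (j / n) (j mod n)

  concatMap-range-support : ∀ {A : Set} (f : ℕ → List A) lo k (ps : List ℕ) →
    AllPairs _<_ ps → All (lo ≤_) ps → All (_< lo + k) ps → (∀ b → lo ≤ b → All (b ≢_) ps → f b ≡ []) →
    concatMap f (range lo k) ≡ concatMap f ps
  concatMap-range-support f lo zero    []       _ _ _ _ = refl
  concatMap-range-support f lo zero    (p ∷ ps) _ (lo≤p ∷ _) (p<lo+0 ∷ _) _ =
    contradiction (subst (p <_) (+-identityʳ lo) p<lo+0) (≤⇒≯ lo≤p)
  concatMap-range-support f lo (suc k) [] _ _ _ vanish =
    cong₂ _++_ (vanish lo ≤-refl []) (concatMap-range-support f (suc lo) k [] [] [] [] (λ b → vanish b ∘ <⇒≤))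
  concatMap-range-support f lo (suc k) (p ∷ ps) (p<ps ∷ sorted) (lo≤p ∷ _) below vanish with p ≟ lo
  ... | yes refl = cong (f p ++_)
    (concatMap-range-support f (suc p) k ps sorted p<ps (All.tail below′)
       (λ b p<b b∉ps → vanish b (<⇒≤ p<b) (≢-sym (<⇒≢ p<b) ∷ b∉ps)))
    where
    below′ = All.map (λ {x} → subst (x <_) (+-suc lo k)) below
  ... | no p≢lo = cong₂ _++_ (vanish lo ≤-refl (<⇒≢ lo<p ∷ All.map (λ p<x → <⇒≢ (<-trans lo<p p<x)) p<ps))
                              (concatMap-range-support f (suc lo) k (p ∷ ps) (p<ps ∷ sorted)
                                 (lo<p ∷ All.map (<-trans lo<p) p<ps) (All.map (λ {x} → subst (x <_) (+-suc lo k)) below)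
                                 (λ b → vanish b ∘ <⇒≤))
    where
    lo<p : lo < p
    lo<p = ≤∧≢⇒< lo≤p (p≢lo ∘ sym)

  concatMap-range-three : ∀ {A : Set} (f : ℕ → List A) {x y z m} → x < y → y < z → z < m →
    (∀ b → b ≢ x → b ≢ y → b ≢ z → f b ≡ []) → concatMap f (range 0 m) ≡ f x ++ f y ++ f z
  concatMap-range-three f {x} {y} {z} {m} x<y y<z z<m vanish = begin
    concatMap f (range 0 m)
      ≡⟨ concatMap-range-support f 0 m (x ∷ y ∷ z ∷ []) sorted (z≤n ∷ z≤n ∷ z≤n ∷ []) (x<m ∷ y<m ∷ z<m ∷ []) vanish′ ⟩
    f x ++ f y ++ f z ++ []
      ≡⟨ cong (λ l → f x ++ f y ++ l) (++-identityʳ (f z)) ⟩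
    f x ++ f y ++ f z ∎
    where
    open ≡-Reasoning
    y<m = <-trans y<z z<m
    x<m = <-trans x<y y<m
    sorted : AllPairs _<_ (x ∷ y ∷ z ∷ [])
    sorted = (x<y ∷ <-trans x<y y<z ∷ []) ∷ (y<z ∷ []) ∷ [] ∷ []
    vanish′ : ∀ b → 0 ≤ b → All (b ≢_) (x ∷ y ∷ z ∷ []) → f b ≡ []
    vanish′ b _ (b≢x ∷ b≢y ∷ b≢z ∷ []) = vanish b b≢x b≢y b≢z

module AffineForms where

  open import Data.Nat as ℕ using (ℕ; zero; suc; z≤n; s≤s)
  open import Data.Integer using (ℤ; +_; 0ℤ; -_; _+_; _-_; _*_; _≤_; _<_; +≤+; +<+; ∣_∣)
  import Data.Integer.Properties as ℤ
  open import Data.Integer.Tactic.RingSolver using (solve-∀)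
  open import Data.Nat.Tactic.RingSolver using () renaming (solve-∀ to solve-∀ℕ)
  open import Data.Product using (_×_; _,_)
  open import Data.Sum using (_⊎_; inj₁; inj₂)
  open import Relation.Binary.PropositionalEquality
  open import Relation.Nullary using (Dec; yes; no)
  open import Relation.Nullary.Decidable using (_×-dec_; _⊎-dec_)

  record Affine : Set where
    constructor affine
    field
      c₀ c₁ c₂ : ℤ

  ⟦_⟧ : Affine → ℕ → ℕ → ℤ
  ⟦ affine a b c ⟧ p q = a + b * + p + c * + q

  infixl 6 _⊕_ _⊖_
  infixr 7 _⊛_
  infix 8 ⊝_

  _⊕_ : Affine → Affine → Affine
  affine a b c ⊕ affine a′ b′ c′ = affine (a + a′) (b + b′) (c + c′)

  ⊝_ : Affine → Affine
  ⊝ affine a b c = affine (- a) (- b) (- c)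

  _⊖_ : Affine → Affine → Affine
  f ⊖ g = f ⊕ ⊝ g

  _⊛_ : ℤ → Affine → Affine
  k ⊛ affine a b c = affine (k * a) (k * b) (k * c)

  constant : ℕ → Affine
  constant k = affine (+ k) 0ℤ 0ℤ

  zeroᴬ : Affine
  zeroᴬ = constant 0

  plusP plusPQ : ℕ → Affine
  plusP  k = affine (+ k) (+ 1) 0ℤ
  plusPQ k = affine (+ k) (+ 1) (+ 1)

  _≟ᴬ_ : (f g : Affine) → Dec (f ≡ g)
  affine a b c ≟ᴬ affine a′ b′ c′ with a ℤ.≟ a′ | b ℤ.≟ b′ | c ℤ.≟ c′
  ... | yes refl | yes refl | yes refl = yes refl
  ... | no a≢a′  | _        | _        = no λ { refl → a≢a′ refl }
  ... | yes _    | no b≢b′  | _        = no λ { refl → b≢b′ refl }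
  ... | yes _    | yes _    | no c≢c′  = no λ { refl → c≢c′ refl }

  module _ (p q : ℕ) where

    ⟦⊕⟧ : ∀ f g → ⟦ f ⊕ g ⟧ p q ≡ ⟦ f ⟧ p q + ⟦ g ⟧ p q
    ⟦⊕⟧ (affine a b c) (affine a′ b′ c′) = ring a b c a′ b′ c′ (+ p) (+ q)
      where
      ring : ∀ a b c a′ b′ c′ x y →
        (a + a′) + (b + b′) * x + (c + c′) * y ≡ (a + b * x + c * y) + (a′ + b′ * x + c′ * y)
      ring = solve-∀

    ⟦⊝⟧ : ∀ f → ⟦ ⊝ f ⟧ p q ≡ - ⟦ f ⟧ p q
    ⟦⊝⟧ (affine a b c) = ring a b c (+ p) (+ q)
      where
      ring : ∀ a b c x y → - a + - b * x + - c * y ≡ - (a + b * x + c * y)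
      ring = solve-∀

    ⟦⊖⟧ : ∀ f g → ⟦ f ⊖ g ⟧ p q ≡ ⟦ f ⟧ p q - ⟦ g ⟧ p q
    ⟦⊖⟧ f g = trans (⟦⊕⟧ f (⊝ g)) (cong (λ z → ⟦ f ⟧ p q + z) (⟦⊝⟧ g))

    ⟦⊛⟧ : ∀ k f → ⟦ k ⊛ f ⟧ p q ≡ k * ⟦ f ⟧ p q
    ⟦⊛⟧ k (affine a b c) = ring k a b c (+ p) (+ q)
      where
      ring : ∀ k a b c x y → k * a + k * b * x + k * c * y ≡ k * (a + b * x + c * y)
      ring = solve-∀

    ⟦constant⟧ : ∀ k → ⟦ constant k ⟧ p q ≡ + k
    ⟦constant⟧ k = ring (+ k) (+ p) (+ q)
      where
      ring : ∀ k x y → k + 0ℤ * x + 0ℤ * y ≡ k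
      ring = solve-∀

    ⟦ℕ⟧ : ∀ a b c → ⟦ affine (+ a) (+ b) (+ c) ⟧ p q ≡ + (a ℕ.+ b ℕ.* p ℕ.+ c ℕ.* q)
    ⟦ℕ⟧ a b c = sym (begin
      + (a ℕ.+ b ℕ.* p ℕ.+ c ℕ.* q)    ≡⟨ ℤ.pos-+ (a ℕ.+ b ℕ.* p) (c ℕ.* q) ⟩
      + (a ℕ.+ b ℕ.* p) + + (c ℕ.* q)  ≡⟨ cong₂ _+_ (ℤ.pos-+ a (b ℕ.* p)) (ℤ.pos-* c q) ⟩
      + a + + (b ℕ.* p) + + c * + q    ≡⟨ cong (λ z → + a + z + + c * + q) (ℤ.pos-* b p) ⟩
      + a + + b * + p + + c * + q      ∎)
      where open ≡-Reasoning

    ⟦plusP⟧ : ∀ k → ⟦ plusP k ⟧ p q ≡ + (k ℕ.+ p)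
    ⟦plusP⟧ k = trans (⟦ℕ⟧ k 1 0) (cong +_ (ring k p q))
      where
      ring : ∀ k p q → k ℕ.+ 1 ℕ.* p ℕ.+ 0 ℕ.* q ≡ k ℕ.+ p
      ring = solve-∀ℕ

    ⟦plusPQ⟧ : ∀ k → ⟦ plusPQ k ⟧ p q ≡ + (k ℕ.+ p ℕ.+ q)
    ⟦plusPQ⟧ k = trans (⟦ℕ⟧ k 1 1) (cong +_ (ring k p q))
      where
      ring : ∀ k p q → k ℕ.+ 1 ℕ.* p ℕ.+ 1 ℕ.* q ≡ k ℕ.+ p ℕ.+ q
      ring = solve-∀ℕ

  -- Coefficientwise sign conditions; as p, q ≥ 0 they carry over to every value of the form.
  Positive NonNegative : Affine → Set
  Positive    (affine a b c) = 0ℤ < a × 0ℤ ≤ b × 0ℤ ≤ c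
  NonNegative (affine a b c) = 0ℤ ≤ a × 0ℤ ≤ b × 0ℤ ≤ c

  positive? : ∀ f → Dec (Positive f)
  positive? (affine a b c) = (0ℤ ℤ.<? a) ×-dec (0ℤ ℤ.≤? b) ×-dec (0ℤ ℤ.≤? c)

  nonNegative? : ∀ f → Dec (NonNegative f)
  nonNegative? (affine a b c) = (0ℤ ℤ.≤? a) ×-dec (0ℤ ℤ.≤? b) ×-dec (0ℤ ℤ.≤? c)

  positive-sound : ∀ f {p q} → Positive f → 0ℤ < ⟦ f ⟧ p q
  positive-sound (affine (+ suc a) (+ b) (+ c)) {p} {q} _ =
    subst (0ℤ <_) (sym (⟦ℕ⟧ p q (suc a) b c)) (+<+ (s≤s z≤n))
  positive-sound (affine (+ zero) _ _) (+<+ () , _)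

  nonNegative-sound : ∀ f {p q} → NonNegative f → 0ℤ ≤ ⟦ f ⟧ p q
  nonNegative-sound (affine (+ a) (+ b) (+ c)) {p} {q} _ =
    subst (0ℤ ≤_) (sym (⟦ℕ⟧ p q a b c)) (+≤+ z≤n)

  -- Separated B d certifies 0 < ∣ d ∣ ≤ B pointwise.
  Separated : Affine → Affine → Set
  Separated B d = (Positive d × NonNegative (B ⊖ d)) ⊎ (Positive (⊝ d) × NonNegative (B ⊕ d))

  separated? : ∀ B d → Dec (Separated B d)
  separated? B d = (positive? d ×-dec nonNegative? (B ⊖ d)) ⊎-dec (positive? (⊝ d) ×-dec nonNegative? (B ⊕ d))

  private
    positive-bounded : ∀ {x b} → 0ℤ < x → x ≤ + b → x ≢ 0ℤ × ∣ x ∣ ℕ.≤ b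
    positive-bounded {+ suc _} _ x≤b = (λ ()) , ℤ.drop‿+≤+ x≤b
    positive-bounded {+ zero} (+<+ ()) _

  separated-sound : ∀ B d {p q b} → ⟦ B ⟧ p q ≡ + b → Separated B d →
                    ⟦ d ⟧ p q ≢ 0ℤ × ∣ ⟦ d ⟧ p q ∣ ℕ.≤ b
  separated-sound B d {p} {q} {b} B≡b (inj₁ (d>0 , B-d≥0)) =
    positive-bounded (positive-sound d d>0) (ℤ.0≤i-j⇒j≤i (subst (0ℤ ≤_) B-d≡ (nonNegative-sound _ B-d≥0)))
    where
    B-d≡ : ⟦ B ⊖ d ⟧ p q ≡ + b - ⟦ d ⟧ p q
    B-d≡ = trans (⟦⊖⟧ p q B d) (cong (_- ⟦ d ⟧ p q) B≡b)
  separated-sound B d {p} {q} {b} B≡b (inj₂ (-d>0 , B+d≥0))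
    with positive-bounded {x = - ⟦ d ⟧ p q} (subst (0ℤ <_) (⟦⊝⟧ p q d) (positive-sound (⊝ d) -d>0))
           (ℤ.0≤i-j⇒j≤i (subst (0ℤ ≤_) B+d≡ (nonNegative-sound _ B+d≥0)))
    where
    B+d≡ : ⟦ B ⊕ d ⟧ p q ≡ + b - - ⟦ d ⟧ p q
    B+d≡ = trans (⟦⊕⟧ p q B d) (cong₂ _+_ B≡b (sym (ℤ.neg-involutive (⟦ d ⟧ p q))))
  ... | -d≢0 , ∣-d∣≤b =
    (λ d≡0 → -d≢0 (cong -_ d≡0)) , subst (ℕ._≤ b) (ℤ.∣-i∣≡∣i∣ (⟦ d ⟧ p q)) ∣-d∣≤b

module CertifiedLines where

  open import Data.Nat as ℕ using (ℕ; NonZero)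
  open import Data.Integer using (ℤ; +_; 0ℤ; _+_; _-_; _*_; ∣_∣)
  open import Data.Integer.DivMod using (_%ℕ_; _/ℕ_; a≡a%ℕn+[a/ℕn]*n)
  import Data.Integer.Properties as ℤ
  import Data.Nat.Properties as ℕ
  open import Data.Integer.Tactic.RingSolver using (solve-∀)
  open import Data.List using (List; []; _∷_; map; foldr; length)
  open import Data.List.Properties using (map-∘)
  open import Data.List.Relation.Unary.AllPairs as AllPairs using (AllPairs; allPairs?)
  open import Data.List.Relation.Unary.AllPairs.Properties using (map⁺)
  open import Data.Vec using (Vec; toList; fromList) renaming (_∷_ to _∷ᵛ_; [] to []ᵛ)
  open import Data.Vec.Properties using (toList∘fromList)
  open import Data.Product using (Σ; _×_; _,_)
  open import Function using (_∘_)
  open import Relation.Binary.PropositionalEquality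
  open import Relation.Nullary using (Dec)
  open import Relation.Nullary.Decidable using (_×-dec_)
  open AffineForms

  -- Defs.partialSums keeps its accumulator in a where-block, out of reach of induction;
  -- scanFrom _+_ (+ 0) computes the same list, and the two agree definitionally on every
  -- list of known length.
  scanFrom : {A : Set} → (A → A → A) → A → List A → List A
  scanFrom _∙_ acc []       = []
  scanFrom _∙_ acc (x ∷ xs) = acc ∙ x ∷ scanFrom _∙_ (acc ∙ x) xs

  map-scanFrom : ∀ {A B : Set} {_∙_ : A → A → A} {_◦_ : B → B → B} (h : A → B) →
                 (∀ x y → h (x ∙ y) ≡ h x ◦ h y) →
                 ∀ acc xs → map h (scanFrom _∙_ acc xs) ≡ scanFrom _◦_ (h acc) (map h xs)
  map-scanFrom h hom acc []       = refl
  map-scanFrom {_∙_ = _∙_} {_◦_} h hom acc (x ∷ xs) = cong₂ _∷_ (hom acc x)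
    (trans (map-scanFrom h hom (acc ∙ x) xs) (cong (λ a → scanFrom _◦_ a (map h xs)) (hom acc x)))

  toList-of-length : ∀ {A : Set} {n} (xs : List A) → length xs ≡ n → Σ (Vec A n) λ v → toList v ≡ xs
  toList-of-length xs refl = fromList xs , toList∘fromList xs

  partialSums≡scanFrom : ∀ xs → length xs ≡ 9 → partialSums xs ≡ scanFrom _+_ 0ℤ xs
  partialSums≡scanFrom xs len with toList-of-length xs len
  ... | _ ∷ᵛ _ ∷ᵛ _ ∷ᵛ _ ∷ᵛ _ ∷ᵛ _ ∷ᵛ _ ∷ᵛ _ ∷ᵛ _ ∷ᵛ []ᵛ , refl = refl

  %ℕ-injective-close : ∀ x y {v} .{{_ : NonZero v}} → x %ℕ v ≡ y %ℕ v → ∣ x - y ∣ ℕ.< v → x ≡ y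
  %ℕ-injective-close x y {v} x≡y ∣x-y∣<v = ℤ.i-j≡0⇒i≡j x y (begin
      x - y       ≡⟨ x-y≡k*v ⟩
      k * + v     ≡⟨ cong (_* + v) (ℤ.∣i∣≡0⇒i≡0 {k} ∣k∣≡0) ⟩
      0ℤ          ∎)
    where
    open ≡-Reasoning
    k = x /ℕ v - y /ℕ v
    x-y≡k*v : x - y ≡ k * + v
    x-y≡k*v = begin
      x - y
        ≡⟨ cong₂ _-_ (a≡a%ℕn+[a/ℕn]*n x v) (a≡a%ℕn+[a/ℕn]*n y v) ⟩
      (+ (x %ℕ v) + x /ℕ v * + v) - (+ (y %ℕ v) + y /ℕ v * + v)
        ≡⟨ cong (λ r → (+ (x %ℕ v) + x /ℕ v * + v) - (+ r + y /ℕ v * + v)) (sym x≡y) ⟩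
      (+ (x %ℕ v) + x /ℕ v * + v) - (+ (x %ℕ v) + y /ℕ v * + v)
        ≡⟨ ring (+ (x %ℕ v)) (x /ℕ v) (y /ℕ v) (+ v) ⟩
      k * + v ∎
      where
      ring : ∀ r a b w → (r + a * w) - (r + b * w) ≡ (a - b) * w
      ring = solve-∀
    ∣k∣≡0 : ∣ k ∣ ≡ 0
    ∣k∣≡0 = ℕ.n<1⇒n≡0 (ℕ.*-cancelʳ-< v ∣ k ∣ 1
              (subst (ℕ._< 1 ℕ.* v) (trans (cong ∣_∣ x-y≡k*v) (ℤ.abs-* k (+ v)))
                (subst (∣ x - y ∣ ℕ.<_) (sym (ℕ.*-identityˡ v)) ∣x-y∣<v)))

  sumᴬ : List Affine → Affine
  sumᴬ = foldr _⊕_ zeroᴬ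

  Certificate : Affine → List Affine → Set
  Certificate B fs = sumᴬ fs ≡ zeroᴬ × AllPairs (λ f g → Separated B (f ⊖ g)) (scanFrom _⊕_ zeroᴬ fs)

  certificate? : ∀ B fs → Dec (Certificate B fs)
  certificate? B fs = (sumᴬ fs ≟ᴬ zeroᴬ) ×-dec allPairs? (λ f g → separated? B (f ⊖ g)) (scanFrom _⊕_ zeroᴬ fs)

  module _ {p q : ℕ} where

    private
      E : Affine → ℤ
      E f = ⟦ f ⟧ p q

    sumℤ-map-⟦⟧ : ∀ fs → sumℤ (map E fs) ≡ E (sumᴬ fs)
    sumℤ-map-⟦⟧ []       = sym (⟦constant⟧ p q 0)
    sumℤ-map-⟦⟧ (f ∷ fs) = trans (cong (λ z → E f + z) (sumℤ-map-⟦⟧ fs)) (sym (⟦⊕⟧ p q f (sumᴬ fs)))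

    certificate-sum : ∀ {B} fs → Certificate B fs → sumℤ (map E fs) ≡ 0ℤ
    certificate-sum fs (sum≡0 , _) = trans (sumℤ-map-⟦⟧ fs) (trans (cong E sum≡0) (⟦constant⟧ p q 0))

    certificate-simple : ∀ {B b} v .{{_ : NonZero v}} → E B ≡ + b → b ℕ.< v → ∀ fs →
                         length fs ≡ 9 → Certificate B fs → SimpleMod v (map E fs)
    certificate-simple {B} v B≡b b<v fs len (_ , separated) =
      subst (λ ss → AllPairs _≢_ (map (_%ℕ v) ss)) (sym partialSums≡) distinct
      where
      ss = scanFrom _⊕_ zeroᴬ fs
      partialSums≡ : partialSums (map E fs) ≡ map E ss
      partialSums≡ = trans (partialSums≡scanFrom (map E fs) (trans (length-map E fs) len))
                           (sym (map-scanFrom E (⟦⊕⟧ p q) zeroᴬ fs))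
        where open import Data.List.Properties using (length-map)
      distinct-mod : ∀ {f g} → Separated B (f ⊖ g) → E f %ℕ v ≢ E g %ℕ v
      distinct-mod {f} {g} sep f≡g with separated-sound B (f ⊖ g) B≡b sep
      ... | f-g≢0 , ∣f-g∣≤b = f-g≢0 (trans (⟦⊖⟧ p q f g) (ℤ.i≡j⇒i-j≡0 (%ℕ-injective-close (E f) (E g) f≡g
            (ℕ.≤-<-trans (ℕ.≤-reflexive (cong ∣_∣ (sym (⟦⊖⟧ p q f g)))) (ℕ.≤-<-trans ∣f-g∣≤b b<v)))))
      distinct : AllPairs _≢_ (map (_%ℕ v) (map E ss))
      distinct = subst (AllPairs _≢_) (map-∘ ss) (map⁺ (AllPairs.map (λ {f} {g} → distinct-mod {f} {g}) separated))

module Construction where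

  open import Data.Nat as ℕ using (ℕ; suc; _∸_; _<_)
  open import Data.Fin using (Fin; toℕ)
  open import Data.Integer using (ℤ; +_; -_; _+_; _-_; _*_; _◃_)
  import Data.Integer.Properties as ℤ
  open import Data.Sign as Sign using (Sign)
  open import Data.Integer.Tactic.RingSolver using (solve-∀)
  open import Relation.Binary.PropositionalEquality
  open Arithmetic using (pos-∸)
  open AffineForms

  -- The array has 4 × 4 blocks indexed by ℤ/m; D r is the entry (r, r) of a diagonal
  -- block (a, a), E₁ r s and E₂ r s the entry (r, s) of the blocks (a, a+1) and (a, a+2).
  data Tag : Set where
    D     : Fin 4 → Tag
    E₁ E₂ : Fin 4 → Fin 4 → Tag

  data Shape : Set where
    ascending descending : Shape
    alternating : Fin 2 → Shape

  offset : Shape → ℕ → ℕ → ℕ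
  offset ascending       m ℓ = ℓ
  offset descending      m ℓ = m ∸ suc ℓ
  offset (alternating p) m ℓ = toℕ p ℕ.+ (m ∸ suc ℓ) ℕ.* 2

  record Entry : Set where
    constructor entry
    field
      sign  : Sign
      band  : ℕ
      shape : Shape

  open Entry public

  -- The magnitudes 1 … 36m are cut into 36 bands of length m: tag t with shape ascending
  -- or descending fills band (band t), the alternating tags D r and D (r + 2) share the
  -- two bands band t and band t + 1.
  entryOf : Tag → Entry
  entryOf (D 0F)     = entry Sign.- 6  (alternating 1F)
  entryOf (D 1F)     = entry Sign.+ 11 (alternating 1F)
  entryOf (D 2F)     = entry Sign.- 6  (alternating 0F)
  entryOf (D 3F)     = entry Sign.+ 11 (alternating 0F)
  entryOf (E₁ 0F 0F) = entry Sign.+ 4  descending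
  entryOf (E₁ 0F 1F) = entry Sign.+ 31 ascending
  entryOf (E₁ 0F 2F) = entry Sign.- 27 ascending
  entryOf (E₁ 0F 3F) = entry Sign.- 16 ascending
  entryOf (E₁ 1F 0F) = entry Sign.- 14 descending
  entryOf (E₁ 1F 1F) = entry Sign.- 5  ascending
  entryOf (E₁ 1F 2F) = entry Sign.+ 17 ascending
  entryOf (E₁ 1F 3F) = entry Sign.- 20 descending
  entryOf (E₁ 2F 0F) = entry Sign.+ 21 descending
  entryOf (E₁ 2F 1F) = entry Sign.- 28 descending
  entryOf (E₁ 2F 2F) = entry Sign.- 15 ascending
  entryOf (E₁ 2F 3F) = entry Sign.+ 23 descending
  entryOf (E₁ 3F 0F) = entry Sign.- 25 descending
  entryOf (E₁ 3F 1F) = entry Sign.+ 32 descending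
  entryOf (E₁ 3F 2F) = entry Sign.- 34 descending
  entryOf (E₁ 3F 3F) = entry Sign.- 33 descending
  entryOf (E₂ 0F 0F) = entry Sign.+ 0  ascending
  entryOf (E₂ 0F 1F) = entry Sign.+ 3  ascending
  entryOf (E₂ 0F 2F) = entry Sign.- 2  ascending
  entryOf (E₂ 0F 3F) = entry Sign.+ 13 descending
  entryOf (E₂ 1F 0F) = entry Sign.- 9  ascending
  entryOf (E₂ 1F 1F) = entry Sign.- 35 descending
  entryOf (E₂ 1F 2F) = entry Sign.+ 26 descending
  entryOf (E₂ 1F 3F) = entry Sign.+ 29 ascending
  entryOf (E₂ 2F 0F) = entry Sign.+ 19 descending
  entryOf (E₂ 2F 1F) = entry Sign.- 1  ascending
  entryOf (E₂ 2F 2F) = entry Sign.+ 18 ascending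
  entryOf (E₂ 2F 3F) = entry Sign.- 30 descending
  entryOf (E₂ 3F 0F) = entry Sign.+ 10 descending
  entryOf (E₂ 3F 1F) = entry Sign.- 8  descending
  entryOf (E₂ 3F 2F) = entry Sign.+ 24 descending
  entryOf (E₂ 3F 3F) = entry Sign.+ 22 ascending

  magnitude : Tag → ℕ → ℕ → ℕ
  magnitude t m ℓ = suc (offset (shape (entryOf t)) m ℓ ℕ.+ band (entryOf t) ℕ.* m)

  value : Tag → ℕ → ℕ → ℤ
  value t m ℓ = sign (entryOf t) ◃ magnitude t m ℓ

  offsetᴬ : Shape → Affine → Affine → Affine
  offsetᴬ ascending       M L = L
  offsetᴬ descending      M L = M ⊖ constant 1 ⊖ L
  offsetᴬ (alternating p) M L = constant (toℕ p) ⊕ + 2 ⊛ (M ⊖ constant 1 ⊖ L)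

  signᴬ : Sign → Affine → Affine
  signᴬ Sign.+ f = f
  signᴬ Sign.- f = ⊝ f

  magnitudeᴬ : Tag → Affine → Affine → Affine
  magnitudeᴬ t M L = constant 1 ⊕ offsetᴬ (shape (entryOf t)) M L ⊕ + band (entryOf t) ⊛ M

  valueᴬ : Tag → Affine → Affine → Affine
  valueᴬ t M L = signᴬ (sign (entryOf t)) (magnitudeᴬ t M L)

  module _ {m ℓ p q : ℕ} {M L : Affine} (m≡M : + m ≡ ⟦ M ⟧ p q) (ℓ≡L : + ℓ ≡ ⟦ L ⟧ p q) (ℓ<m : ℓ < m) where

    private
      E : Affine → ℤ
      E f = ⟦ f ⟧ p q

    ⟦descending⟧ : + (m ∸ suc ℓ) ≡ E (M ⊖ constant 1 ⊖ L)
    ⟦descending⟧ = begin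
      + (m ∸ suc ℓ)                   ≡⟨ pos-∸ ℓ<m ⟩
      + m - + suc ℓ                   ≡⟨ cong₂ _-_ m≡M (trans (ℤ.pos-+ 1 ℓ) (cong (λ z → + 1 + z) ℓ≡L)) ⟩
      E M - (+ 1 + E L)               ≡⟨ ring (E M) (E L) ⟩
      E M - + 1 - E L                 ≡⟨ cong (λ z → E M - z - E L) (sym (⟦constant⟧ p q 1)) ⟩
      E M - E (constant 1) - E L      ≡⟨ cong (_- E L) (sym (⟦⊖⟧ p q M (constant 1))) ⟩
      E (M ⊖ constant 1) - E L        ≡⟨ sym (⟦⊖⟧ p q (M ⊖ constant 1) L) ⟩
      E (M ⊖ constant 1 ⊖ L)          ∎
      where
      open ≡-Reasoning
      ring : ∀ x y → x - (+ 1 + y) ≡ x - + 1 - y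
      ring = solve-∀

    ⟦offset⟧ : ∀ s → + offset s m ℓ ≡ E (offsetᴬ s M L)
    ⟦offset⟧ ascending       = ℓ≡L
    ⟦offset⟧ descending      = ⟦descending⟧
    ⟦offset⟧ (alternating i) = begin
      + (toℕ i ℕ.+ x ℕ.* 2)          ≡⟨ ℤ.pos-+ (toℕ i) (x ℕ.* 2) ⟩
      + toℕ i + + (x ℕ.* 2)          ≡⟨ cong₂ _+_ (sym (⟦constant⟧ p q (toℕ i)))
                                                   (trans (ℤ.pos-* x 2) (ℤ.*-comm (+ x) (+ 2))) ⟩
      E I + + 2 * + x                ≡⟨ cong (λ z → E I + + 2 * z) ⟦descending⟧ ⟩
      E I + + 2 * E X                ≡⟨ cong (λ z → E I + z) (sym (⟦⊛⟧ p q (+ 2) X)) ⟩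
      E I + E (+ 2 ⊛ X)              ≡⟨ sym (⟦⊕⟧ p q I (+ 2 ⊛ X)) ⟩
      E (offsetᴬ (alternating i) M L) ∎
      where
      open ≡-Reasoning
      x = m ∸ suc ℓ
      X = M ⊖ constant 1 ⊖ L
      I = constant (toℕ i)

    ⟦magnitude⟧ : ∀ t → + magnitude t m ℓ ≡ E (magnitudeᴬ t M L)
    ⟦magnitude⟧ t = begin
      + suc (o ℕ.+ K ℕ.* m)                ≡⟨ ℤ.pos-+ 1 (o ℕ.+ K ℕ.* m) ⟩
      + 1 + + (o ℕ.+ K ℕ.* m)              ≡⟨ cong (λ z → + 1 + z)
                                                   (trans (ℤ.pos-+ o (K ℕ.* m)) (cong (λ z → + o + z) (ℤ.pos-* K m))) ⟩
      + 1 + (+ o + + K * + m)              ≡⟨ sym (ℤ.+-assoc (+ 1) (+ o) (+ K * + m)) ⟩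
      + 1 + + o + + K * + m                ≡⟨ cong₂ (λ x y → x + y + + K * + m) (sym (⟦constant⟧ p q 1)) (⟦offset⟧ s) ⟩
      E (constant 1) + E O + + K * + m     ≡⟨ cong₂ _+_ (sym (⟦⊕⟧ p q (constant 1) O))
                                                   (trans (cong (+ K *_) m≡M) (sym (⟦⊛⟧ p q (+ K) M))) ⟩
      E (constant 1 ⊕ O) + E (+ K ⊛ M)     ≡⟨ sym (⟦⊕⟧ p q (constant 1 ⊕ O) (+ K ⊛ M)) ⟩
      E (magnitudeᴬ t M L)                 ∎
      where
      open ≡-Reasoning
      s = shape (entryOf t)
      K = band (entryOf t)
      o = offset s m ℓ
      O = offsetᴬ s M L

    ⟦value⟧ : ∀ t → value t m ℓ ≡ E (valueᴬ t M L)
    ⟦value⟧ t with sign (entryOf t)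
    ... | Sign.+ = trans (ℤ.+◃n≡+n (magnitude t m ℓ)) (⟦magnitude⟧ t)
    ... | Sign.- = trans (ℤ.-◃n≡-n (magnitude t m ℓ))
                     (trans (cong -_ (⟦magnitude⟧ t)) (sym (⟦⊝⟧ p q (magnitudeᴬ t M L))))

module Bands where

  open import Data.Nat
  open import Data.Nat.Properties
  open import Data.Nat.DivMod using (_mod_)
  open import Data.Fin using (Fin; toℕ)
  open import Data.Fin.Properties using (toℕ<n)
  open import Data.Maybe using (Maybe; just; nothing)
  open import Data.List using (List; []; _∷_; head; drop; length)
  open import Data.Vec using (Vec; lookup) renaming (_∷_ to _∷ᵛ_; [] to []ᵛ)
  open import Data.Product using (Σ; _×_; _,_)
  open import Data.Sum using (inj₁; inj₂)
  open import Relation.Binary.PropositionalEquality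
  open Arithmetic
  open Construction

  -- shared ts K: the bands K and K + 1 hold lookup ts i at the offsets of parity i.
  data Band : Set where
    single : Tag → Band
    shared : Vec Tag 2 → ℕ → Band

  bandTable : List Band
  bandTable =
    single (E₂ 0F 0F) ∷
    single (E₂ 2F 1F) ∷
    single (E₂ 0F 2F) ∷
    single (E₂ 0F 1F) ∷
    single (E₁ 0F 0F) ∷
    single (E₁ 1F 1F) ∷
    shared (D 2F ∷ᵛ D 0F ∷ᵛ []ᵛ) 6 ∷
    shared (D 2F ∷ᵛ D 0F ∷ᵛ []ᵛ) 6 ∷
    single (E₂ 3F 1F) ∷
    single (E₂ 1F 0F) ∷
    single (E₂ 3F 0F) ∷
    shared (D 3F ∷ᵛ D 1F ∷ᵛ []ᵛ) 11 ∷
    shared (D 3F ∷ᵛ D 1F ∷ᵛ []ᵛ) 11 ∷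
    single (E₂ 0F 3F) ∷
    single (E₁ 1F 0F) ∷
    single (E₁ 2F 2F) ∷
    single (E₁ 0F 3F) ∷
    single (E₁ 1F 2F) ∷
    single (E₂ 2F 2F) ∷
    single (E₂ 2F 0F) ∷
    single (E₁ 1F 3F) ∷
    single (E₁ 2F 0F) ∷
    single (E₂ 3F 3F) ∷
    single (E₁ 2F 3F) ∷
    single (E₂ 3F 2F) ∷
    single (E₁ 3F 0F) ∷
    single (E₂ 1F 2F) ∷
    single (E₁ 0F 2F) ∷
    single (E₁ 2F 1F) ∷
    single (E₂ 1F 3F) ∷
    single (E₂ 2F 3F) ∷
    single (E₁ 0F 1F) ∷
    single (E₁ 3F 1F) ∷
    single (E₁ 3F 3F) ∷
    single (E₁ 3F 2F) ∷
    single (E₂ 1F 1F) ∷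
    []

  bandOccupant : ℕ → Maybe Band
  bandOccupant K = head (drop K bandTable)

  head-drop-< : ∀ {A : Set} (xs : List A) K {x} → head (drop K xs) ≡ just x → K < length xs
  head-drop-< (_ ∷ _)  zero    _   = s≤s z≤n
  head-drop-< (_ ∷ xs) (suc K) eq  = s≤s (head-drop-< xs K eq)
  head-drop-< []       zero    ()
  head-drop-< []       (suc K) ()

  bandOccupant-<36 : ∀ K {b} → bandOccupant K ≡ just b → K < 36
  bandOccupant-<36 = head-drop-< bandTable

  PlacedAs : Shape → ℕ → Tag → Set
  PlacedAs ascending       K t = bandOccupant K ≡ just (single t)
  PlacedAs descending      K t = bandOccupant K ≡ just (single t)
  PlacedAs (alternating i) K t = Σ (Vec Tag 2) λ ts →
    bandOccupant K ≡ just (shared ts K) × bandOccupant (suc K) ≡ just (shared ts K) × lookup ts i ≡ t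

  placed : ∀ t → PlacedAs (shape (entryOf t)) (band (entryOf t)) t
  placed (D 0F)     = _ , refl , refl , refl
  placed (D 1F)     = _ , refl , refl , refl
  placed (D 2F)     = _ , refl , refl , refl
  placed (D 3F)     = _ , refl , refl , refl
  placed (E₁ 0F 0F) = refl
  placed (E₁ 0F 1F) = refl
  placed (E₁ 0F 2F) = refl
  placed (E₁ 0F 3F) = refl
  placed (E₁ 1F 0F) = refl
  placed (E₁ 1F 1F) = refl
  placed (E₁ 1F 2F) = refl
  placed (E₁ 1F 3F) = refl
  placed (E₁ 2F 0F) = refl
  placed (E₁ 2F 1F) = refl
  placed (E₁ 2F 2F) = refl
  placed (E₁ 2F 3F) = refl
  placed (E₁ 3F 0F) = refl
  placed (E₁ 3F 1F) = refl
  placed (E₁ 3F 2F) = refl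
  placed (E₁ 3F 3F) = refl
  placed (E₂ 0F 0F) = refl
  placed (E₂ 0F 1F) = refl
  placed (E₂ 0F 2F) = refl
  placed (E₂ 0F 3F) = refl
  placed (E₂ 1F 0F) = refl
  placed (E₂ 1F 1F) = refl
  placed (E₂ 1F 2F) = refl
  placed (E₂ 1F 3F) = refl
  placed (E₂ 2F 0F) = refl
  placed (E₂ 2F 1F) = refl
  placed (E₂ 2F 2F) = refl
  placed (E₂ 2F 3F) = refl
  placed (E₂ 3F 0F) = refl
  placed (E₂ 3F 1F) = refl
  placed (E₂ 3F 2F) = refl
  placed (E₂ 3F 3F) = refl

  -- Inverts offset for the shapes ascending and descending; alternating bands are decoded
  -- through their shared entry instead.
  position : Shape → ℕ → ℕ → ℕ
  position descending m h = m ∸ suc h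
  position _          m h = h

  decodeIn : (m : ℕ) .{{_ : NonZero m}} → ℕ → Maybe Band → Maybe (Tag × ℕ)
  decodeIn m y (just (single t))    = just (t , position (shape (entryOf t)) m (y % m))
  decodeIn m y (just (shared ts K)) = just (lookup ts (h mod 2) , m ∸ suc (h / 2))
    where h = y ∸ K * m
  decodeIn m y nothing              = nothing

  decode : (m : ℕ) .{{_ : NonZero m}} → ℕ → Maybe (Tag × ℕ)
  decode m μ = decodeIn m (μ ∸ 1) (bandOccupant ((μ ∸ 1) / m))

  alternating-offset-< : ∀ (i : Fin 2) {x m} → x < m → toℕ i + x * 2 < 2 * m
  alternating-offset-< i {x} {m} x<m = begin-strict
    toℕ i + x * 2   <⟨ +-monoˡ-< (x * 2) (toℕ<n i) ⟩
    2 + x * 2       ≡⟨ *-comm (suc x) 2 ⟩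
    2 * suc x       ≤⟨ *-monoʳ-≤ 2 x<m ⟩
    2 * m           ∎
    where open ≤-Reasoning

  module _ {m : ℕ} .{{_ : NonZero m}} where

    decode-single : ∀ t {h} → h < m → bandOccupant (band (entryOf t)) ≡ just (single t) →
                    decode m (suc (h + band (entryOf t) * m)) ≡ just (t , position (shape (entryOf t)) m h)
    decode-single t {h} h<m occ = begin
      decodeIn m y (bandOccupant (y / m))  ≡⟨ cong (λ k → decodeIn m y (bandOccupant k)) ([r+q*n]/n≡q K m h<m) ⟩
      decodeIn m y (bandOccupant K)        ≡⟨ cong (decodeIn m y) occ ⟩
      just (t , position s m (y % m))      ≡⟨ cong (λ z → just (t , position s m z)) ([r+q*n]%n≡r K m h<m) ⟩
      just (t , position s m h)            ∎
      where
      open ≡-Reasoning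
      K = band (entryOf t)
      s = shape (entryOf t)
      y = h + K * m

    decode-shared : ∀ ts K i {x} → x < m →
                    bandOccupant K ≡ just (shared ts K) → bandOccupant (suc K) ≡ just (shared ts K) →
                    decode m (suc (toℕ i + x * 2 + K * m)) ≡ just (lookup ts i , m ∸ suc x)
    decode-shared ts K i {x} x<m occ occ′ = begin
      decodeIn m y (bandOccupant (y / m))  ≡⟨ cong (decodeIn m y) occupant ⟩
      just (lookup ts (h mod 2) , m ∸ suc (h / 2)) ≡⟨ cong₂ (λ j z → just (lookup ts j , m ∸ suc z)) h-mod-2 h/2 ⟩
      just (lookup ts i , m ∸ suc x)       ∎
      where
      open ≡-Reasoning
      y = toℕ i + x * 2 + K * m
      h = y ∸ K * m
      h≡ : h ≡ toℕ i + x * 2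
      h≡ = m+n∸n≡m (toℕ i + x * 2) (K * m)
      h-mod-2 : h mod 2 ≡ i
      h-mod-2 = trans (cong (_mod 2) h≡) ([i+q*n]mod-n≡i i x)
      h/2 : h / 2 ≡ x
      h/2 = trans (cong (_/ 2) h≡) ([r+q*n]/n≡q x 2 (toℕ<n i))
      occupant : bandOccupant (y / m) ≡ just (shared ts K)
      occupant with [h+q*n]/n-below-double K m (alternating-offset-< i x<m)
      ... | inj₁ y/m≡K  = trans (cong bandOccupant y/m≡K) occ
      ... | inj₂ y/m≡K+1 = trans (cong bandOccupant y/m≡K+1) occ′

    decode-magnitude : ∀ t {ℓ} → ℓ < m → decode m (magnitude t m ℓ) ≡ just (t , ℓ)
    decode-magnitude t {ℓ} ℓ<m = by-shape (shape (entryOf t)) refl (placed t)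
      where
      K = band (entryOf t)
      by-shape : ∀ s → shape (entryOf t) ≡ s → PlacedAs s K t →
                 decode m (suc (offset s m ℓ + K * m)) ≡ just (t , ℓ)
      by-shape ascending shape≡ occ =
        trans (decode-single t ℓ<m occ) (cong (λ s → just (t , position s m ℓ)) shape≡)
      by-shape descending shape≡ occ =
        trans (decode-single t (∸-suc-< ℓ<m) occ)
              (trans (cong (λ s → just (t , position s m (m ∸ suc ℓ))) shape≡)
                     (cong (λ z → just (t , z)) (∸-suc-involutive ℓ<m)))
      by-shape (alternating i) _ (ts , occ , occ′ , ts[i]≡t) =
        trans (decode-shared ts K i (∸-suc-< ℓ<m) occ occ′)
              (cong₂ (λ t′ z → just (t′ , z)) ts[i]≡t (∸-suc-involutive ℓ<m))

    magnitude-injective : ∀ t t′ {ℓ ℓ′} → ℓ < m → ℓ′ < m →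
                          magnitude t m ℓ ≡ magnitude t′ m ℓ′ → t ≡ t′ × ℓ ≡ ℓ′
    magnitude-injective t t′ ℓ<m ℓ′<m eq
      with trans (sym (decode-magnitude t ℓ<m)) (trans (cong (decode m) eq) (decode-magnitude t′ ℓ′<m))
    ... | refl = refl , refl

  magnitude-≤ : ∀ t {m ℓ} → ℓ < m → magnitude t m ℓ ≤ 36 * m
  magnitude-≤ t {m} {ℓ} ℓ<m = by-shape (shape (entryOf t)) (placed t)
    where
    K = band (entryOf t)
    within : ∀ {o} w → o < w * m → w + K ≤ 36 → suc (o + K * m) ≤ 36 * m
    within {o} w o<wm w+K≤36 = begin
      suc o + K * m   ≤⟨ +-monoˡ-≤ (K * m) o<wm ⟩
      w * m + K * m   ≡⟨ *-distribʳ-+ m w K ⟨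
      (w + K) * m     ≤⟨ *-monoˡ-≤ m w+K≤36 ⟩
      36 * m          ∎
      where open ≤-Reasoning
    below-1*m : ∀ {o} → o < m → o < 1 * m
    below-1*m {o} = subst (o <_) (sym (*-identityˡ m))
    by-shape : ∀ s → PlacedAs s K t → suc (offset s m ℓ + K * m) ≤ 36 * m
    by-shape ascending  occ = within 1 (below-1*m ℓ<m) (bandOccupant-<36 K occ)
    by-shape descending occ = within 1 (below-1*m (∸-suc-< ℓ<m)) (bandOccupant-<36 K occ)
    by-shape (alternating i) (_ , _ , occ′ , _) =
      within 2 (alternating-offset-< i (∸-suc-< ℓ<m)) (bandOccupant-<36 (suc K) occ′)

module Layout where

  open import Data.Nat
  open import Data.Nat.Properties
  open import Data.Nat.DivMod using (_mod_)
  open import Data.Fin as Fin using (Fin; toℕ)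
  open import Data.Integer using (ℤ)
  open import Data.Bool using (true; false; if_then_else_; T)
  open import Data.Maybe using (Maybe; just; nothing)
  open import Data.Maybe.Properties using (just-injective)
  open import Data.List using (List; []; [_]; map; mapMaybe; concatMap; allFin)
  open import Data.List.Properties using (mapMaybe-cong)
  open import Data.Product using (Σ; _×_; _,_)
  open import Function using (_∘_)
  open import Relation.Binary.PropositionalEquality hiding ([_])
  open import Relation.Nullary using (does; yes; no)
  open import Relation.Nullary.Decidable using (dec-true; dec-false)
  open import Relation.Nullary.Negation using (contradiction)
  open import Data.Sum using (_⊎_; inj₁; inj₂)
  open Ranges
  open Construction

  ≡ᵇ-true : ∀ {x y} → x ≡ y → (x ≡ᵇ y) ≡ true
  ≡ᵇ-true {x} {y} = dec-true (x ≟ y)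

  ≡ᵇ-false : ∀ {x y} → x ≢ y → (x ≡ᵇ y) ≡ false
  ≡ᵇ-false {x} {y} = dec-false (x ≟ y)

  ≡ᵇ-true⇒≡ : ∀ {x y} → (x ≡ᵇ y) ≡ true → x ≡ y
  ≡ᵇ-true⇒≡ {x} {y} eq = ≡ᵇ⇒≡ x y (subst T (sym eq) _)

  sucMod : ℕ → ℕ → ℕ
  sucMod m x = if suc x ≡ᵇ m then 0 else suc x

  sucMod-suc : ∀ {m x} → suc x ≢ m → sucMod m x ≡ suc x
  sucMod-suc ne rewrite ≡ᵇ-false ne = refl

  sucMod-wrap : ∀ {m x} → suc x ≡ m → sucMod m x ≡ 0
  sucMod-wrap eq rewrite ≡ᵇ-true eq = refl

  sucMod-cases : ∀ m x → (suc x ≢ m × sucMod m x ≡ suc x) ⊎ (suc x ≡ m × sucMod m x ≡ 0)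
  sucMod-cases m x with suc x ≟ m
  ... | yes eq = inj₂ (eq , sucMod-wrap eq)
  ... | no ne  = inj₁ (ne , sucMod-suc ne)

  sucMod-injective : ∀ {m x y} → sucMod m x ≡ sucMod m y → x ≡ y
  sucMod-injective {m} {x} {y} eq with sucMod-cases m x | sucMod-cases m y
  ... | inj₁ (_ , ex) | inj₁ (_ , ey) = suc-injective (trans (sym ex) (trans eq ey))
  ... | inj₂ (x+1≡m , _) | inj₂ (y+1≡m , _) = suc-injective (trans x+1≡m (sym y+1≡m))
  ... | inj₁ (_ , ex) | inj₂ (_ , ey) = contradiction (trans (sym ex) (trans eq ey)) λ ()
  ... | inj₂ (_ , ex) | inj₁ (_ , ey) = contradiction (trans (sym ex) (trans eq ey)) λ ()

  -- The entry in row r of block row a and column s of block column b.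
  cell : ℕ → ℕ → Fin 4 → ℕ → Fin 4 → Maybe ℤ
  cell m a r b s =
    if b ≡ᵇ a then (if does (r Fin.≟ s) then just (value (D r) m a) else nothing)
    else if b ≡ᵇ sucMod m a then just (value (E₁ r s) m a)
    else if b ≡ᵇ sucMod m (sucMod m a) then just (value (E₂ r s) m b)
    else nothing

  array : (m : ℕ) → Array (4 * m)
  array m i j = cell m (toℕ i / 4) (toℕ i mod 4) (toℕ j / 4) (toℕ j mod 4)

  data CellOf (m : ℕ) : Tag → ℕ → ℕ → Fin 4 → ℕ → Fin 4 → Set where
    diag  : ∀ a r → CellOf m (D r) a a r a r
    next  : ∀ a r s → CellOf m (E₁ r s) a a r (sucMod m a) s
    next² : ∀ a r s {b} → sucMod m (sucMod m a) ≡ b → CellOf m (E₂ r s) b a r b s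

  cell-inv : ∀ m a r b s {x} → cell m a r b s ≡ just x →
             Σ Tag λ t → Σ ℕ λ ℓ → x ≡ value t m ℓ × CellOf m t ℓ a r b s
  cell-inv m a r b s eq
    with b ≡ᵇ a in b≡a | r Fin.≟ s | b ≡ᵇ sucMod m a in b≡a⁺ | b ≡ᵇ sucMod m (sucMod m a) in b≡a⁺⁺
  ... | true  | yes refl | _     | _    = D r , a , sym (just-injective eq) ,
    subst (λ b → CellOf m (D r) a a r b r) (sym (≡ᵇ-true⇒≡ b≡a)) (diag a r)
  ... | false | _        | true  | _    = E₁ r s , a , sym (just-injective eq) ,
    subst (λ b → CellOf m (E₁ r s) a a r b s) (sym (≡ᵇ-true⇒≡ b≡a⁺)) (next a r s)
  ... | false | _        | false | true = E₂ r s , b , sym (just-injective eq) , next² a r s (sym (≡ᵇ-true⇒≡ b≡a⁺⁺))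
  cell-inv m a r b s () | true  | no _ | _     | _
  cell-inv m a r b s () | false | _    | false | false

  cellOf-unique : ∀ {m t ℓ a r b s a′ r′ b′ s′} → CellOf m t ℓ a r b s → CellOf m t ℓ a′ r′ b′ s′ →
                  a ≡ a′ × r ≡ r′ × b ≡ b′ × s ≡ s′
  cellOf-unique (diag a r)      (diag _ _)       = refl , refl , refl , refl
  cellOf-unique (next a r s)    (next _ _ _)     = refl , refl , refl , refl
  cellOf-unique {m} (next² a r s e) (next² a′ _ _ e′) =
    sucMod-injective {m} (sucMod-injective {m} (trans e (sym e′))) , refl , refl , refl

  cellOf-< : ∀ {m t ℓ a r b s} → CellOf m t ℓ a r b s → a < m → b < m → ℓ < m
  cellOf-< (diag _ _)       a<m _   = a<m
  cellOf-< (next _ _ _)     a<m _   = a<m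
  cellOf-< (next² _ _ _ _)  _   b<m = b<m

  module _ {m a : ℕ} where

    cell-next : ∀ {b} → b ≢ a → b ≡ sucMod m a → ∀ r s → cell m a r b s ≡ just (value (E₁ r s) m a)
    cell-next b≢a b≡a⁺ r s rewrite ≡ᵇ-false b≢a | ≡ᵇ-true b≡a⁺ = refl

    cell-next² : ∀ {b} → b ≢ a → b ≢ sucMod m a → b ≡ sucMod m (sucMod m a) →
                 ∀ r s → cell m a r b s ≡ just (value (E₂ r s) m b)
    cell-next² b≢a b≢a⁺ b≡a⁺⁺ r s rewrite ≡ᵇ-false b≢a | ≡ᵇ-false b≢a⁺ | ≡ᵇ-true b≡a⁺⁺ = refl

    cell-far : ∀ {b} → b ≢ a → b ≢ sucMod m a → b ≢ sucMod m (sucMod m a) → ∀ r s → cell m a r b s ≡ nothing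
    cell-far b≢a b≢a⁺ b≢a⁺⁺ r s rewrite ≡ᵇ-false b≢a | ≡ᵇ-false b≢a⁺ | ≡ᵇ-false b≢a⁺⁺ = refl

    cell-diag : ∀ r s → cell m a r a s ≡ (if does (r Fin.≟ s) then just (value (D r) m a) else nothing)
    cell-diag r s rewrite ≡ᵇ-true {a} refl = refl

  rowSegment : ℕ → ℕ → Fin 4 → ℕ → List ℤ
  rowSegment m a r b = mapMaybe (cell m a r b) (allFin 4)

  colSegment : ℕ → ℕ → Fin 4 → ℕ → List ℤ
  colSegment m b s a = mapMaybe (λ r → cell m a r b s) (allFin 4)

  rowOf : ℕ → ℕ → Fin 4 → List ℤ
  rowOf m a r = concatMap (rowSegment m a r) (range 0 m)

  colOf : ℕ → ℕ → Fin 4 → List ℤ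
  colOf m b s = concatMap (colSegment m b s) (range 0 m)

  row-array : ∀ m i → row (array m) i ≡ rowOf m (toℕ i / 4) (toℕ i mod 4)
  row-array m i = mapMaybe-allFin-blocks 4 (cell m (toℕ i / 4) (toℕ i mod 4)) m

  col-array : ∀ m j → col (array m) j ≡ colOf m (toℕ j / 4) (toℕ j mod 4)
  col-array m j = mapMaybe-allFin-blocks 4 (λ a r → cell m a r (toℕ j / 4) (toℕ j mod 4)) m

  module _ {m a : ℕ} where

    rowSegment-diag : ∀ r → rowSegment m a r a ≡ [ value (D r) m a ]
    rowSegment-diag r = trans (mapMaybe-cong (cell-diag {m} {a} r) (allFin 4)) (by-row r)
      where
      by-row : ∀ r → mapMaybe (λ s → if does (r Fin.≟ s) then just (value (D r) m a) else nothing) (allFin 4)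
                     ≡ [ value (D r) m a ]
      by-row 0F = refl
      by-row 1F = refl
      by-row 2F = refl
      by-row 3F = refl

    colSegment-diag : ∀ s → colSegment m a s a ≡ [ value (D s) m a ]
    colSegment-diag s = trans (mapMaybe-cong (λ r → cell-diag {m} {a} r s) (allFin 4)) (by-col s)
      where
      by-col : ∀ s → mapMaybe (λ r → if does (r Fin.≟ s) then just (value (D r) m a) else nothing) (allFin 4)
                     ≡ [ value (D s) m a ]
      by-col 0F = refl
      by-col 1F = refl
      by-col 2F = refl
      by-col 3F = refl

  module _ {m a b : ℕ} where

    rowSegment-next : b ≢ a → b ≡ sucMod m a → ∀ r → rowSegment m a r b ≡ map (λ s → value (E₁ r s) m a) (allFin 4)
    rowSegment-next b≢a b≡a⁺ r = mapMaybe-cong (cell-next {m} {a} b≢a b≡a⁺ r) (allFin 4)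

    rowSegment-next² : b ≢ a → b ≢ sucMod m a → b ≡ sucMod m (sucMod m a) →
                       ∀ r → rowSegment m a r b ≡ map (λ s → value (E₂ r s) m b) (allFin 4)
    rowSegment-next² b≢a b≢a⁺ b≡a⁺⁺ r = mapMaybe-cong (cell-next² {m} {a} b≢a b≢a⁺ b≡a⁺⁺ r) (allFin 4)

    rowSegment-far : b ≢ a → b ≢ sucMod m a → b ≢ sucMod m (sucMod m a) → ∀ r → rowSegment m a r b ≡ []
    rowSegment-far b≢a b≢a⁺ b≢a⁺⁺ r = mapMaybe-cong (cell-far {m} {a} b≢a b≢a⁺ b≢a⁺⁺ r) (allFin 4)

    colSegment-next : b ≢ a → b ≡ sucMod m a → ∀ s → colSegment m b s a ≡ map (λ r → value (E₁ r s) m a) (allFin 4)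
    colSegment-next b≢a b≡a⁺ s = mapMaybe-cong (λ r → cell-next {m} {a} b≢a b≡a⁺ r s) (allFin 4)

    colSegment-next² : b ≢ a → b ≢ sucMod m a → b ≡ sucMod m (sucMod m a) →
                       ∀ s → colSegment m b s a ≡ map (λ r → value (E₂ r s) m b) (allFin 4)
    colSegment-next² b≢a b≢a⁺ b≡a⁺⁺ s = mapMaybe-cong (λ r → cell-next² {m} {a} b≢a b≢a⁺ b≡a⁺⁺ r s) (allFin 4)

    colSegment-far : b ≢ a → b ≢ sucMod m a → b ≢ sucMod m (sucMod m a) → ∀ s → colSegment m b s a ≡ []
    colSegment-far b≢a b≢a⁺ b≢a⁺⁺ s = mapMaybe-cong (λ r → cell-far {m} {a} b≢a b≢a⁺ b≢a⁺⁺ r s) (allFin 4)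

  rowSegment-outside : ∀ {m a a₁ a₂ b} → sucMod m a ≡ a₁ → sucMod m a₁ ≡ a₂ →
                       b ≢ a → b ≢ a₁ → b ≢ a₂ → ∀ r → rowSegment m a r b ≡ []
  rowSegment-outside refl refl = rowSegment-far

  -- The block rows meeting block column b are b, its predecessor y and the predecessor x of y.
  colSegment-outside : ∀ {m a b x y} → sucMod m y ≡ b → sucMod m (sucMod m x) ≡ b →
                       a ≢ b → a ≢ y → a ≢ x → ∀ s → colSegment m b s a ≡ []
  colSegment-outside {m} {a} y⁺≡b x⁺⁺≡b a≢b a≢y a≢x =
    colSegment-far (a≢b ∘ sym)
      (λ b≡a⁺ → a≢y (sucMod-injective {m} (trans (sym b≡a⁺) (sym y⁺≡b))))
      (λ b≡a⁺⁺ → a≢x (sucMod-injective {m} (sucMod-injective {m} (trans (sym b≡a⁺⁺) (sym x⁺⁺≡b)))))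

module Lines where

  open import Data.Nat
  open import Data.Nat.Properties
  open import Data.Nat.Tactic.RingSolver using (solve-∀)
  open import Data.Fin using (Fin)
  open import Data.Integer using (ℤ; +_; 0ℤ) renaming (_*_ to _*ℤ_)
  open import Data.Integer.Properties using (pos-*)
  open import Data.List using (List; []; _∷_; _++_; map; length; allFin)
  open import Data.List.Properties using (map-++; map-cong; map-∘; length-map)
  open import Data.Product using (_×_; _,_)
  open import Data.Unit using (tt)
  open import Relation.Binary.PropositionalEquality
  open import Relation.Nullary.Decidable using (True; toWitness)
  open import Data.Fin.Properties using (all?)
  open AffineForms
  open CertifiedLines
  open Construction
  open Ranges
  open Layout

  record GoodLine (m : ℕ) (xs : List ℤ) : Set where
    field
      length≡9 : length xs ≡ 9
      sum≡0    : sumℤ xs ≡ 0ℤ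
      simple₁  : SimpleMod (suc (2 * (4 * m) * 9)) xs
      simple₂  : SimpleMod (suc (suc (2 * (4 * m) * 9))) xs

  goodLine : ∀ {m p q} M → + m ≡ ⟦ M ⟧ p q → ∀ fs → length fs ≡ 9 → Certificate (+ 72 ⊛ M) fs →
             GoodLine m (map (λ f → ⟦ f ⟧ p q) fs)
  goodLine {m} {p} {q} M m≡M fs len cert = record
    { length≡9 = trans (length-map (λ f → ⟦ f ⟧ p q) fs) len
    ; sum≡0    = certificate-sum {B = B} fs cert
    ; simple₁  = certificate-simple {B = B} _ B≡72m (s≤s (≤-reflexive 72m≡)) fs len cert
    ; simple₂  = certificate-simple {B = B} _ B≡72m (s≤s (m≤n⇒m≤1+n (≤-reflexive 72m≡))) fs len cert
    }
    where
    B = + 72 ⊛ M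
    B≡72m : ⟦ B ⟧ p q ≡ + (72 * m)
    B≡72m = trans (⟦⊛⟧ p q (+ 72) M) (trans (cong (+ 72 *ℤ_) (sym m≡M)) (sym (pos-* 72 m)))
    72m≡ : 72 * m ≡ 2 * (4 * m) * 9
    72m≡ = ring m
      where
      ring : ∀ m → 72 * m ≡ 2 * (4 * m) * 9
      ring = solve-∀

  valuesAt : ℕ → ℕ → List Tag → List ℤ
  valuesAt m ℓ = map (λ t → value t m ℓ)

  formsAt : Affine → Affine → List Tag → List Affine
  formsAt M L = map (λ t → valueᴬ t M L)

  module _ {m : ℕ} (p q : ℕ) (M : Affine) (m≡M : + m ≡ ⟦ M ⟧ p q) where

    private
      E : Affine → ℤ
      E f = ⟦ f ⟧ p q

    valuesAt≡⟦formsAt⟧ : ∀ {ℓ} L → + ℓ ≡ E L → ℓ < m → ∀ ts → valuesAt m ℓ ts ≡ map E (formsAt M L ts)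
    valuesAt≡⟦formsAt⟧ L ℓ≡L ℓ<m ts = trans (map-cong (⟦value⟧ m≡M ℓ≡L ℓ<m) ts) (map-∘ ts)

    valuesAt₃≡⟦formsAt₃⟧ : ∀ {ℓ₁ ℓ₂ ℓ₃} L₁ L₂ L₃ →
      + ℓ₁ ≡ E L₁ × ℓ₁ < m → + ℓ₂ ≡ E L₂ × ℓ₂ < m → + ℓ₃ ≡ E L₃ × ℓ₃ < m → ∀ ts₁ ts₂ ts₃ →
      valuesAt m ℓ₁ ts₁ ++ valuesAt m ℓ₂ ts₂ ++ valuesAt m ℓ₃ ts₃
        ≡ map E (formsAt M L₁ ts₁ ++ formsAt M L₂ ts₂ ++ formsAt M L₃ ts₃)
    valuesAt₃≡⟦formsAt₃⟧ L₁ L₂ L₃ (ℓ₁≡ , ℓ₁<m) (ℓ₂≡ , ℓ₂<m) (ℓ₃≡ , ℓ₃<m) ts₁ ts₂ ts₃ = begin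
      valuesAt _ _ ts₁ ++ valuesAt _ _ ts₂ ++ valuesAt _ _ ts₃
        ≡⟨ cong₂ _++_ (valuesAt≡⟦formsAt⟧ L₁ ℓ₁≡ ℓ₁<m ts₁)
                      (cong₂ _++_ (valuesAt≡⟦formsAt⟧ L₂ ℓ₂≡ ℓ₂<m ts₂) (valuesAt≡⟦formsAt⟧ L₃ ℓ₃≡ ℓ₃<m ts₃)) ⟩
      map E F₁ ++ map E F₂ ++ map E F₃
        ≡⟨ cong (map E F₁ ++_) (map-++ E F₂ F₃) ⟨
      map E F₁ ++ map E (F₂ ++ F₃)
        ≡⟨ map-++ E F₁ (F₂ ++ F₃) ⟨
      map E (F₁ ++ F₂ ++ F₃) ∎
      where
      open ≡-Reasoning
      F₁ = formsAt M L₁ ts₁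
      F₂ = formsAt M L₂ ts₂
      F₃ = formsAt M L₃ ts₃

  diagTags rowTags₁ rowTags₂ colTags₁ colTags₂ : Fin 4 → List Tag
  diagTags r = D r ∷ []
  rowTags₁ r = map (E₁ r) (allFin 4)
  rowTags₂ r = map (E₂ r) (allFin 4)
  colTags₁ s = map (λ r → E₁ r s) (allFin 4)
  colTags₂ s = map (λ r → E₂ r s) (allFin 4)

  -- The nine entries of each kind of line, in order, as affine forms; the line kinds are
  -- parametrised by (p, q) with m = 3 + p + q (interior lines) or m = 3 + p (lines meeting
  -- the wrap-around of the block indices).
  interiorRowForms penultimateRowForms lastRowForms : Fin 4 → List Affine
  interiorRowForms r = formsAt (plusPQ 3) (plusP 0) (diagTags r) ++ formsAt (plusPQ 3) (plusP 0) (rowTags₁ r)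
                    ++ formsAt (plusPQ 3) (plusP 2) (rowTags₂ r)
  penultimateRowForms r = formsAt (plusP 3) (constant 0) (rowTags₂ r) ++ formsAt (plusP 3) (plusP 1) (diagTags r)
                       ++ formsAt (plusP 3) (plusP 1) (rowTags₁ r)
  lastRowForms r = formsAt (plusP 3) (plusP 2) (rowTags₁ r) ++ formsAt (plusP 3) (constant 1) (rowTags₂ r)
                ++ formsAt (plusP 3) (plusP 2) (diagTags r)

  interiorColForms firstColForms secondColForms : Fin 4 → List Affine
  interiorColForms s = formsAt (plusPQ 3) (plusP 2) (colTags₂ s) ++ formsAt (plusPQ 3) (plusP 1) (colTags₁ s)
                    ++ formsAt (plusPQ 3) (plusP 2) (diagTags s)
  firstColForms s = formsAt (plusP 3) (constant 0) (diagTags s) ++ formsAt (plusP 3) (constant 0) (colTags₂ s)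
                 ++ formsAt (plusP 3) (plusP 2) (colTags₁ s)
  secondColForms s = formsAt (plusP 3) (constant 0) (colTags₁ s) ++ formsAt (plusP 3) (constant 1) (diagTags s)
                  ++ formsAt (plusP 3) (constant 1) (colTags₂ s)

  certified : ∀ M (forms : Fin 4 → List Affine) → True (all? (λ r → certificate? (+ 72 ⊛ M) (forms r))) →
              ∀ r → Certificate (+ 72 ⊛ M) (forms r)
  certified M forms = toWitness

  interiorRow-certified : ∀ r → Certificate (+ 72 ⊛ plusPQ 3) (interiorRowForms r)
  interiorRow-certified = certified (plusPQ 3) interiorRowForms tt

  penultimateRow-certified : ∀ r → Certificate (+ 72 ⊛ plusP 3) (penultimateRowForms r)
  penultimateRow-certified = certified (plusP 3) penultimateRowForms tt

  lastRow-certified : ∀ r → Certificate (+ 72 ⊛ plusP 3) (lastRowForms r)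
  lastRow-certified = certified (plusP 3) lastRowForms tt

  interiorCol-certified : ∀ s → Certificate (+ 72 ⊛ plusPQ 3) (interiorColForms s)
  interiorCol-certified = certified (plusPQ 3) interiorColForms tt

  firstCol-certified : ∀ s → Certificate (+ 72 ⊛ plusP 3) (firstColForms s)
  firstCol-certified = certified (plusP 3) firstColForms tt

  secondCol-certified : ∀ s → Certificate (+ 72 ⊛ plusP 3) (secondColForms s)
  secondCol-certified = certified (plusP 3) secondColForms tt

  rowOf-interior : ∀ a c r → GoodLine (3 + a + c) (rowOf (3 + a + c) a r)
  rowOf-interior a c r =
    subst (GoodLine m) (sym row≡) (goodLine (plusPQ 3) m≡M (interiorRowForms r) refl (interiorRow-certified r))
    where
    m = 3 + a + c
    m≡M : + m ≡ ⟦ plusPQ 3 ⟧ a c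
    m≡M = sym (⟦plusPQ⟧ a c 3)
    a+2<m : suc (suc a) < m
    a+2<m = s≤s (s≤s (s≤s (m≤m+n a c)))
    a+1<m = <-trans (n<1+n (suc a)) a+2<m
    a<m   = <-trans (n<1+n a) a+1<m
    a⁺≡ : sucMod m a ≡ suc a
    a⁺≡ = sucMod-suc {m} (<⇒≢ a+1<m)
    a⁺⁺≡ : sucMod m (suc a) ≡ suc (suc a)
    a⁺⁺≡ = sucMod-suc {m} (<⇒≢ a+2<m)
    row≡ : rowOf m a r ≡ map (λ f → ⟦ f ⟧ a c) (interiorRowForms r)
    row≡ = begin
      rowOf m a r
        ≡⟨ concatMap-range-three (rowSegment m a r) (n<1+n a) (n<1+n (suc a)) a+2<m
             (λ b b≢a b≢a+1 b≢a+2 → rowSegment-outside {m} a⁺≡ a⁺⁺≡ b≢a b≢a+1 b≢a+2 r) ⟩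
      rowSegment m a r a ++ rowSegment m a r (suc a) ++ rowSegment m a r (suc (suc a))
        ≡⟨ cong₂ _++_ (rowSegment-diag r)
             (cong₂ _++_ (rowSegment-next (>⇒≢ (n<1+n a)) (sym a⁺≡) r)
                         (rowSegment-next² (>⇒≢ (<-trans (n<1+n a) (n<1+n (suc a))))
                                           (subst (suc (suc a) ≢_) (sym a⁺≡) (>⇒≢ (n<1+n (suc a))))
                                           (sym (trans (cong (sucMod m) a⁺≡) a⁺⁺≡)) r)) ⟩
      valuesAt m a (diagTags r) ++ valuesAt m a (rowTags₁ r) ++ valuesAt m (suc (suc a)) (rowTags₂ r)
        ≡⟨ valuesAt₃≡⟦formsAt₃⟧ a c (plusPQ 3) m≡M (plusP 0) (plusP 0) (plusP 2)
             (sym (⟦plusP⟧ a c 0) , a<m) (sym (⟦plusP⟧ a c 0) , a<m) (sym (⟦plusP⟧ a c 2) , a+2<m)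
             (diagTags r) (rowTags₁ r) (rowTags₂ r) ⟩
      map (λ f → ⟦ f ⟧ a c) (interiorRowForms r) ∎
      where open ≡-Reasoning

  rowOf-penultimate : ∀ c r → GoodLine (3 + c) (rowOf (3 + c) (suc c) r)
  rowOf-penultimate c r =
    subst (GoodLine m) (sym row≡) (goodLine (plusP 3) m≡M (penultimateRowForms r) refl (penultimateRow-certified r))
    where
    m = 3 + c
    m≡M : + m ≡ ⟦ plusP 3 ⟧ c 0
    m≡M = sym (⟦plusP⟧ c 0 3)
    a⁺≡ : sucMod m (suc c) ≡ suc (suc c)
    a⁺≡ = sucMod-suc {m} (<⇒≢ (n<1+n (suc (suc c))))
    a⁺⁺≡ : sucMod m (suc (suc c)) ≡ 0
    a⁺⁺≡ = sucMod-wrap {m} refl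
    row≡ : rowOf m (suc c) r ≡ map (λ f → ⟦ f ⟧ c 0) (penultimateRowForms r)
    row≡ = begin
      rowOf m (suc c) r
        ≡⟨ concatMap-range-three (rowSegment m (suc c) r) (s≤s z≤n) (n<1+n (suc c)) (n<1+n (suc (suc c)))
             (λ b b≢0 b≢c+1 b≢c+2 → rowSegment-outside {m} a⁺≡ a⁺⁺≡ b≢c+1 b≢c+2 b≢0 r) ⟩
      rowSegment m (suc c) r 0 ++ rowSegment m (suc c) r (suc c) ++ rowSegment m (suc c) r (suc (suc c))
        ≡⟨ cong₂ _++_ (rowSegment-next² (λ ()) (subst (0 ≢_) (sym a⁺≡) (λ ())) (sym (trans (cong (sucMod m) a⁺≡) a⁺⁺≡)) r)
             (cong₂ _++_ (rowSegment-diag r) (rowSegment-next (>⇒≢ (n<1+n (suc c))) (sym a⁺≡) r)) ⟩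
      valuesAt m 0 (rowTags₂ r) ++ valuesAt m (suc c) (diagTags r) ++ valuesAt m (suc c) (rowTags₁ r)
        ≡⟨ valuesAt₃≡⟦formsAt₃⟧ c 0 (plusP 3) m≡M (constant 0) (plusP 1) (plusP 1)
             (sym (⟦constant⟧ c 0 0) , s≤s z≤n) (sym (⟦plusP⟧ c 0 1) , s≤s (s≤s (m≤n+m c 1)))
             (sym (⟦plusP⟧ c 0 1) , s≤s (s≤s (m≤n+m c 1)))
             (rowTags₂ r) (diagTags r) (rowTags₁ r) ⟩
      map (λ f → ⟦ f ⟧ c 0) (penultimateRowForms r) ∎
      where open ≡-Reasoning

  rowOf-last : ∀ c r → GoodLine (3 + c) (rowOf (3 + c) (suc (suc c)) r)
  rowOf-last c r =
    subst (GoodLine m) (sym row≡) (goodLine (plusP 3) m≡M (lastRowForms r) refl (lastRow-certified r))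
    where
    m = 3 + c
    m≡M : + m ≡ ⟦ plusP 3 ⟧ c 0
    m≡M = sym (⟦plusP⟧ c 0 3)
    a⁺≡ : sucMod m (suc (suc c)) ≡ 0
    a⁺≡ = sucMod-wrap {m} refl
    a⁺⁺≡ : sucMod m 0 ≡ 1
    a⁺⁺≡ = sucMod-suc {m} (λ ())
    row≡ : rowOf m (suc (suc c)) r ≡ map (λ f → ⟦ f ⟧ c 0) (lastRowForms r)
    row≡ = begin
      rowOf m (suc (suc c)) r
        ≡⟨ concatMap-range-three (rowSegment m (suc (suc c)) r) (s≤s z≤n) (s≤s (s≤s z≤n)) (n<1+n (suc (suc c)))
             (λ b b≢0 b≢1 b≢c+2 → rowSegment-outside {m} a⁺≡ a⁺⁺≡ b≢c+2 b≢0 b≢1 r) ⟩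
      rowSegment m (suc (suc c)) r 0 ++ rowSegment m (suc (suc c)) r 1 ++ rowSegment m (suc (suc c)) r (suc (suc c))
        ≡⟨ cong₂ _++_ (rowSegment-next (λ ()) (sym a⁺≡) r)
             (cong₂ _++_ (rowSegment-next² (λ ()) (subst (1 ≢_) (sym a⁺≡) (λ ())) (sym (trans (cong (sucMod m) a⁺≡) a⁺⁺≡)) r)
                         (rowSegment-diag r)) ⟩
      valuesAt m (suc (suc c)) (rowTags₁ r) ++ valuesAt m 1 (rowTags₂ r) ++ valuesAt m (suc (suc c)) (diagTags r)
        ≡⟨ valuesAt₃≡⟦formsAt₃⟧ c 0 (plusP 3) m≡M (plusP 2) (constant 1) (plusP 2)
             (sym (⟦plusP⟧ c 0 2) , n<1+n (suc (suc c))) (sym (⟦constant⟧ c 0 1) , s≤s (s≤s z≤n))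
             (sym (⟦plusP⟧ c 0 2) , n<1+n (suc (suc c)))
             (rowTags₁ r) (rowTags₂ r) (diagTags r) ⟩
      map (λ f → ⟦ f ⟧ c 0) (lastRowForms r) ∎
      where open ≡-Reasoning

  colOf-interior : ∀ a c s → GoodLine (3 + a + c) (colOf (3 + a + c) (suc (suc a)) s)
  colOf-interior a c s =
    subst (GoodLine m) (sym col≡) (goodLine (plusPQ 3) m≡M (interiorColForms s) refl (interiorCol-certified s))
    where
    m = 3 + a + c
    b = suc (suc a)
    m≡M : + m ≡ ⟦ plusPQ 3 ⟧ a c
    m≡M = sym (⟦plusPQ⟧ a c 3)
    b<m : b < m
    b<m = s≤s (s≤s (s≤s (m≤m+n a c)))
    a+1<m = <-trans (n<1+n (suc a)) b<m
    a⁺≡ : sucMod m a ≡ suc a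
    a⁺≡ = sucMod-suc {m} (<⇒≢ a+1<m)
    a⁺⁺≡ : sucMod m (suc a) ≡ b
    a⁺⁺≡ = sucMod-suc {m} (<⇒≢ b<m)
    col≡ : colOf m b s ≡ map (λ f → ⟦ f ⟧ a c) (interiorColForms s)
    col≡ = begin
      colOf m b s
        ≡⟨ concatMap-range-three (colSegment m b s) (n<1+n a) (n<1+n (suc a)) b<m
             (λ x x≢a x≢a+1 x≢b → colSegment-outside {m} a⁺⁺≡ (trans (cong (sucMod m) a⁺≡) a⁺⁺≡) x≢b x≢a+1 x≢a s) ⟩
      colSegment m b s a ++ colSegment m b s (suc a) ++ colSegment m b s b
        ≡⟨ cong₂ _++_ (colSegment-next² (>⇒≢ (<-trans (n<1+n a) (n<1+n (suc a))))
                                        (subst (b ≢_) (sym a⁺≡) (>⇒≢ (n<1+n (suc a))))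
                                        (sym (trans (cong (sucMod m) a⁺≡) a⁺⁺≡)) s)
             (cong₂ _++_ (colSegment-next (>⇒≢ (n<1+n (suc a))) (sym a⁺⁺≡) s) (colSegment-diag s)) ⟩
      valuesAt m b (colTags₂ s) ++ valuesAt m (suc a) (colTags₁ s) ++ valuesAt m b (diagTags s)
        ≡⟨ valuesAt₃≡⟦formsAt₃⟧ a c (plusPQ 3) m≡M (plusP 2) (plusP 1) (plusP 2)
             (sym (⟦plusP⟧ a c 2) , b<m) (sym (⟦plusP⟧ a c 1) , a+1<m) (sym (⟦plusP⟧ a c 2) , b<m)
             (colTags₂ s) (colTags₁ s) (diagTags s) ⟩
      map (λ f → ⟦ f ⟧ a c) (interiorColForms s) ∎
      where open ≡-Reasoning

  colOf-first : ∀ c s → GoodLine (3 + c) (colOf (3 + c) 0 s)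
  colOf-first c s =
    subst (GoodLine m) (sym col≡) (goodLine (plusP 3) m≡M (firstColForms s) refl (firstCol-certified s))
    where
    m = 3 + c
    m≡M : + m ≡ ⟦ plusP 3 ⟧ c 0
    m≡M = sym (⟦plusP⟧ c 0 3)
    c+1⁺≡ : sucMod m (suc c) ≡ suc (suc c)
    c+1⁺≡ = sucMod-suc {m} (<⇒≢ (n<1+n (suc (suc c))))
    c+2⁺≡ : sucMod m (suc (suc c)) ≡ 0
    c+2⁺≡ = sucMod-wrap {m} refl
    c+1⁺⁺≡ = trans (cong (sucMod m) c+1⁺≡) c+2⁺≡
    col≡ : colOf m 0 s ≡ map (λ f → ⟦ f ⟧ c 0) (firstColForms s)
    col≡ = begin
      colOf m 0 s
        ≡⟨ concatMap-range-three (colSegment m 0 s) (s≤s z≤n) (n<1+n (suc c)) (n<1+n (suc (suc c)))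
             (λ x x≢0 x≢c+1 x≢c+2 → colSegment-outside {m} c+2⁺≡ c+1⁺⁺≡ x≢0 x≢c+2 x≢c+1 s) ⟩
      colSegment m 0 s 0 ++ colSegment m 0 s (suc c) ++ colSegment m 0 s (suc (suc c))
        ≡⟨ cong₂ _++_ (colSegment-diag s)
             (cong₂ _++_ (colSegment-next² (λ ()) (subst (0 ≢_) (sym c+1⁺≡) (λ ())) (sym c+1⁺⁺≡) s)
                         (colSegment-next (λ ()) (sym c+2⁺≡) s)) ⟩
      valuesAt m 0 (diagTags s) ++ valuesAt m 0 (colTags₂ s) ++ valuesAt m (suc (suc c)) (colTags₁ s)
        ≡⟨ valuesAt₃≡⟦formsAt₃⟧ c 0 (plusP 3) m≡M (constant 0) (constant 0) (plusP 2)
             (sym (⟦constant⟧ c 0 0) , s≤s z≤n) (sym (⟦constant⟧ c 0 0) , s≤s z≤n)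
             (sym (⟦plusP⟧ c 0 2) , n<1+n (suc (suc c)))
             (diagTags s) (colTags₂ s) (colTags₁ s) ⟩
      map (λ f → ⟦ f ⟧ c 0) (firstColForms s) ∎
      where open ≡-Reasoning

  colOf-second : ∀ c s → GoodLine (3 + c) (colOf (3 + c) 1 s)
  colOf-second c s =
    subst (GoodLine m) (sym col≡) (goodLine (plusP 3) m≡M (secondColForms s) refl (secondCol-certified s))
    where
    m = 3 + c
    m≡M : + m ≡ ⟦ plusP 3 ⟧ c 0
    m≡M = sym (⟦plusP⟧ c 0 3)
    0⁺≡ : sucMod m 0 ≡ 1
    0⁺≡ = sucMod-suc {m} (λ ())
    c+2⁺≡ : sucMod m (suc (suc c)) ≡ 0
    c+2⁺≡ = sucMod-wrap {m} refl
    c+2⁺⁺≡ = trans (cong (sucMod m) c+2⁺≡) 0⁺≡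
    col≡ : colOf m 1 s ≡ map (λ f → ⟦ f ⟧ c 0) (secondColForms s)
    col≡ = begin
      colOf m 1 s
        ≡⟨ concatMap-range-three (colSegment m 1 s) (s≤s z≤n) (s≤s (s≤s z≤n)) (n<1+n (suc (suc c)))
             (λ x x≢0 x≢1 x≢c+2 → colSegment-outside {m} 0⁺≡ c+2⁺⁺≡ x≢1 x≢0 x≢c+2 s) ⟩
      colSegment m 1 s 0 ++ colSegment m 1 s 1 ++ colSegment m 1 s (suc (suc c))
        ≡⟨ cong₂ _++_ (colSegment-next (λ ()) (sym 0⁺≡) s)
             (cong₂ _++_ (colSegment-diag s)
                         (colSegment-next² (λ ()) (subst (1 ≢_) (sym c+2⁺≡) (λ ())) (sym c+2⁺⁺≡) s)) ⟩
      valuesAt m 0 (colTags₁ s) ++ valuesAt m 1 (diagTags s) ++ valuesAt m 1 (colTags₂ s)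
        ≡⟨ valuesAt₃≡⟦formsAt₃⟧ c 0 (plusP 3) m≡M (constant 0) (constant 1) (constant 1)
             (sym (⟦constant⟧ c 0 0) , s≤s z≤n) (sym (⟦constant⟧ c 0 1) , s≤s (s≤s z≤n))
             (sym (⟦constant⟧ c 0 1) , s≤s (s≤s z≤n))
             (colTags₁ s) (diagTags s) (colTags₂ s) ⟩
      map (λ f → ⟦ f ⟧ c 0) (secondColForms s) ∎
      where open ≡-Reasoning

  rowOf-good : ∀ {m a} r → 3 ≤ m → a < m → GoodLine m (rowOf m a r)
  rowOf-good {a = a} r 3≤m a<m with m≤n⇒∃[o]m+o≡n a<m
  rowOf-good {a = a}           r _ _ | suc (suc c) , refl =
    subst (λ m → GoodLine m (rowOf m a r)) (ring a c) (rowOf-interior a c r)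
    where
    ring : ∀ a c → 3 + a + c ≡ suc a + suc (suc c)
    ring = solve-∀
  rowOf-good {a = suc c}       r _ _ | 1 , refl =
    subst (λ m → GoodLine m (rowOf m (suc c) r)) (+-comm 1 (suc (suc c))) (rowOf-penultimate c r)
  rowOf-good {a = suc (suc c)} r _ _ | 0 , refl =
    subst (λ m → GoodLine m (rowOf m (suc (suc c)) r)) (sym (+-identityʳ (3 + c))) (rowOf-last c r)
  rowOf-good {a = 0} r (s≤s (s≤s ())) _ | 1 , refl
  rowOf-good {a = 0} r (s≤s ()) _ | 0 , refl
  rowOf-good {a = 1} r (s≤s (s≤s ())) _ | 0 , refl

  colOf-good : ∀ {m b} s → 3 ≤ m → b < m → GoodLine m (colOf m b s)
  colOf-good {b = 0}           s (s≤s (s≤s (s≤s _))) _ = colOf-first _ s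
  colOf-good {b = 1}           s (s≤s (s≤s (s≤s _))) _ = colOf-second _ s
  colOf-good {b = suc (suc a)} s _ b<m with m≤n⇒∃[o]m+o≡n b<m
  ... | c , refl = colOf-interior a c s

open import Data.Nat
open import Data.Nat.Properties
open import Data.Nat.DivMod using (_mod_; m≡m%n+[m/n]*n)
open import Data.Fin using (Fin; toℕ)
open import Data.Nat.Tactic.RingSolver using (solve-∀)
open import Data.Integer using (∣_∣)
open import Data.Integer.Properties using (abs-◃)
open import Data.Maybe using (just)
open import Data.Product using (Σ; _×_; _,_)
open import Function using (_∘_)
open import Relation.Binary.PropositionalEquality
open Arithmetic using (toℕ/-<; index-injective)
open Construction using (Tag; value; magnitude; sign; entryOf)
open Bands using (magnitude-≤; magnitude-injective)
open Layout using (array; cell-inv; CellOf; cellOf-unique; cellOf-<; row-array; col-array)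
open Lines using (GoodLine; rowOf-good; colOf-good)

module _ (m : ℕ) .{{_ : NonZero m}} where

  private
    block-< : ∀ (i : Fin (4 * m)) → toℕ i / 4 < m
    block-< = toℕ/-< {4} {m}

    array-inv : ∀ i j {x} → array m i j ≡ just x → Σ Tag λ t → Σ ℕ λ ℓ →
                x ≡ value t m ℓ × CellOf m t ℓ (toℕ i / 4) (toℕ i mod 4) (toℕ j / 4) (toℕ j mod 4)
    array-inv i j = cell-inv m (toℕ i / 4) (toℕ i mod 4) (toℕ j / 4) (toℕ j mod 4)

  array-entriesOK : EntriesOK (4 * m) 9 (array m)
  array-entriesOK = bounded , injective
    where
    bounded : ∀ i j x → array m i j ≡ just x → 1 ≤ ∣ x ∣ × ∣ x ∣ ≤ 4 * m * 9
    bounded i j x eq with array-inv i j eq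
    ... | t , ℓ , refl , c rewrite abs-◃ (sign (entryOf t)) (magnitude t m ℓ) =
      s≤s z≤n , subst (magnitude t m ℓ ≤_) (ring m) (magnitude-≤ t (cellOf-< c (block-< i) (block-< j)))
      where
      ring : ∀ m → 36 * m ≡ 4 * m * 9
      ring = solve-∀
    injective : ∀ i j i′ j′ x y → array m i j ≡ just x → array m i′ j′ ≡ just y →
                ∣ x ∣ ≡ ∣ y ∣ → i ≡ i′ × j ≡ j′
    injective i j i′ j′ x y eq eq′ ∣x∣≡∣y∣ with array-inv i j eq | array-inv i′ j′ eq′
    ... | t , ℓ , refl , c | t′ , ℓ′ , refl , c′
      with magnitude-injective t t′ (cellOf-< c (block-< i) (block-< j)) (cellOf-< c′ (block-< i′) (block-< j′))
             (trans (sym (abs-◃ (sign (entryOf t)) _)) (trans ∣x∣≡∣y∣ (abs-◃ (sign (entryOf t′)) _)))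
    ... | refl , refl with cellOf-unique c c′
    ... | a≡ , r≡ , b≡ , s≡ = index-injective i i′ a≡ r≡ , index-injective j j′ b≡ s≡

  array-isSHStar : 3 ≤ m → IsSHStar (4 * m) 9 (array m)
  array-isSHStar 3≤m =
    (array-entriesOK , GoodLine.length≡9 ∘ rowGood , GoodLine.length≡9 ∘ colGood ,
                       GoodLine.sum≡0 ∘ rowGood , GoodLine.sum≡0 ∘ colGood) ,
    (λ i → GoodLine.simple₁ (rowGood i) , GoodLine.simple₂ (rowGood i)) ,
    (λ j → GoodLine.simple₁ (colGood j) , GoodLine.simple₂ (colGood j))
    where
    rowGood : ∀ i → GoodLine m (row (array m) i)
    rowGood i = subst (GoodLine m) (sym (row-array m i)) (rowOf-good (toℕ i mod 4) 3≤m (block-< i))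
    colGood : ∀ j → GoodLine m (col (array m) j)
    colGood j = subst (GoodLine m) (sym (col-array m j)) (colOf-good (toℕ j mod 4) 3≤m (block-< j))

proposition4p8 : (n : ℕ) → n % 4 ≡ 0 → 12 ≤ n →
    Σ (Array n) (λ A → IsSHStar n 9 A)
proposition4p8 n n%4≡0 12≤n =
  subst (λ n → Σ (Array n) (λ A → IsSHStar n 9 A)) (sym n≡4m) (array m , array-isSHStar m {{m≢0}} 3≤m)
  where
  m = n / 4
  n≡4m : n ≡ 4 * m
  n≡4m = trans (m≡m%n+[m/n]*n n 4) (trans (cong (_+ m * 4) n%4≡0) (*-comm m 4))
  3≤m : 3 ≤ m
  3≤m = *-cancelˡ-≤ 4 (subst (12 ≤_) n≡4m 12≤n)
  m≢0 : NonZero m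
  m≢0 = >-nonZero (≤-trans (s≤s z≤n) 3≤m)
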